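{- Let $s_n,t_n,u_n,v_n$ be the numbers of $2$-covers, proper $2$-covers, restricted $2$-covers, and restricted proper $2$-covers of $[n]$ (each equal to $1$ for $n=0$), and let $S(x)=\sum_{n\ge0}s_nx^n/n!$, $T(x)=\sum_{n\ge0}t_nx^n/n!$, $U(x)=\sum_{n\ge0}u_nx^n/n!$, $V(x)=\sum_{n\ge0}v_nx^n/n!$ as formal power series. Then $$ S(x)=U(e^x-1),\qquad T(x)=V(e^x-1),\qquad U(x)=V(x)e^x. $$
   Context: A $2$-cover of $[n]$ is a finite multiset $\{S_1,\dots,S_m\}$ of nonempty subsets of $[n]$ (repetitions allowed) such that every $d\in[n]$ lies in $S_j$ for exactly two indices $j$; it is proper if $S_i\neq S_j$ for $i\ne j$, and restricted if $|S_i\cap S_j|\le1$ for $i\ne j$. For $n=0$ the empty multiset is the unique such cover. -}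

module Defs where

open import Data.Bool using (Bool; true; false; if_then_else_; _∧_)
open import Data.Nat using (ℕ; zero; suc; _+_; _∸_; _≤ᵇ_; _≡ᵇ_; _!)
open import Data.Nat.Properties using (_!≢0)
open import Data.Integer using (+_)
open import Data.Rational using (ℚ; 0ℚ; 1ℚ; _/_) renaming (_+_ to _+ℚ_; _*_ to _*ℚ_)
open import Data.List using (List; []; _∷_; map; length; filter; concatMap; allFin)
open import Data.Bool.ListAction using (and)
open import Data.Nat.ListAction using (sum)
open import Data.Vec using (Vec; []; _∷_; lookup)
open import Data.Fin using (Fin)
open import Data.Fin.Subset using (Subset; ∣_∣; _∩_)
open import Data.Product using (_×_; _,_)
open import Relation.Nullary.Decidable using (does)
open import Relation.Unary using (Decidable)
open import Relation.Binary.PropositionalEquality using (_≡_)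
open import Data.Bool using (T)
open import Data.Bool.Properties using (T?)

allSubsets : (n : ℕ) → List (Subset n)
allSubsets zero = [] ∷ []
allSubsets (suc n) = concatMap (λ S → (false ∷ S) ∷ (true ∷ S) ∷ []) (allSubsets n)

_==ˢ_ : ∀ {n} → Subset n → Subset n → Bool
[] ==ˢ [] = true
(false ∷ s) ==ˢ (false ∷ t) = s ==ˢ t
(true ∷ s) ==ˢ (true ∷ t) = s ==ˢ t
(false ∷ s) ==ˢ (true ∷ t) = false
(true ∷ s) ==ˢ (false ∷ t) = false

-- A function  Subset n → A  represented as a complete binary tree of
-- depth n (so that such functions have structural equality).
SubFun : Set → ℕ → Set
SubFun A zero = A
SubFun A (suc n) = SubFun A n × SubFun A n

app : ∀ {A n} → SubFun A n → Subset n → A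
app {n = zero} a [] = a
app {n = suc n} (f , g) (false ∷ s) = app f s
app {n = suc n} (f , g) (true ∷ s) = app g s

-- A finite multiset of subsets of [n] is given by its multiplicity
-- function  Subset n → ℕ.
Multiset : ℕ → Set
Multiset n = SubFun ℕ n

allSubFuns : ∀ {A} → List A → (n : ℕ) → List (SubFun A n)
allSubFuns xs zero = xs
allSubFuns xs (suc n) =
  concatMap (λ f → map (λ g → (f , g)) (allSubFuns xs n)) (allSubFuns xs n)

allS : ∀ {n} → (Subset n → Bool) → Bool
allS {n} p = and (map p (allSubsets n))

degree : ∀ {n} → Multiset n → Fin n → ℕ
degree {n} m d = sum (map (λ S → if lookup S d then app m S else 0) (allSubsets n))

-- 2-cover: every member is nonempty (the empty set has multiplicity 0)
-- and every d ∈ [n] lies in exactly two members.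
isTwoCover : ∀ {n} → Multiset n → Bool
isTwoCover {n} m =
  allS (λ S → if ∣ S ∣ ≡ᵇ 0 then app m S ≡ᵇ 0 else true)
  ∧ and (map (λ d → degree m d ≡ᵇ 2) (allFin n))

-- proper: S_i ≠ S_j for i ≠ j, i.e. all multiplicities ≤ 1
isProper : ∀ {n} → Multiset n → Bool
isProper m = allS (λ S → app m S ≤ᵇ 1)

-- restricted: |S_i ∩ S_j| ≤ 1 for i ≠ j.  Pairs of indices i ≠ j either
-- carry distinct subsets S ≠ S' both occurring, or the same subset S
-- occurring with multiplicity ≥ 2 (then |S ∩ S| = |S| ≤ 1 is required).
isRestricted : ∀ {n} → Multiset n → Bool
isRestricted m =
  allS (λ S → allS (λ S' →
     if (S ==ˢ S') then true
     else if (1 ≤ᵇ app m S) ∧ (1 ≤ᵇ app m S') then ∣ S ∩ S' ∣ ≤ᵇ 1 else true))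
  ∧ allS (λ S → if 2 ≤ᵇ app m S then ∣ S ∣ ≤ᵇ 1 else true)

-- In a 2-cover every nonempty member has multiplicity ≤ 2 and the empty
-- set has multiplicity 0, so every 2-cover occurs among the multiplicity
-- functions with values in {0,1,2}; counting these is counting all covers.
candidates : (n : ℕ) → List (Multiset n)
candidates n = allSubFuns (0 ∷ 1 ∷ 2 ∷ []) n

count : ((n : ℕ) → Multiset n → Bool) → ℕ → ℕ
count P n = length (filter (λ m → T? (P n m)) (candidates n))

s t u v : ℕ → ℕ
s = count (λ n m → isTwoCover m)
t = count (λ n m → isTwoCover m ∧ isProper m)
u = count (λ n m → isTwoCover m ∧ isRestricted m)
v = count (λ n m → isTwoCover m ∧ isRestricted m ∧ isProper m)

PS : Set
PS = ℕ → ℚ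

sumTo : ℕ → (ℕ → ℚ) → ℚ
sumTo zero f = f 0
sumTo (suc n) f = sumTo n f +ℚ f (suc n)

_⊛_ : PS → PS → PS
(f ⊛ g) n = sumTo n (λ k → f k *ℚ g (n ∸ k))

oneS : PS
oneS zero = 1ℚ
oneS (suc n) = 0ℚ

_^S_ : PS → ℕ → PS
f ^S zero = oneS
f ^S suc k = f ⊛ (f ^S k)

egf : (ℕ → ℕ) → PS
egf a n = _/_ (+ a n) (n !) {{n !≢0}}

expS : PS
expS n = _/_ (+ 1) (n !) {{n !≢0}}

expm1 : PS
expm1 zero = 0ℚ
expm1 (suc n) = expS (suc n)

-- composition F(G) for G with zero constant term:
-- [x^n] F(G) = Σ_{k=0}^{n} F_k [x^n] G^k   (as G^k has order ≥ k)
_∘S_ : PS → PS → PS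
(F ∘S G) n = sumTo n (λ k → F k *ℚ (G ^S k) n)

-- Call two points of a 2-cover twins if they lie in exactly the same members. For a 2-cover,
-- restricted is the same as twin-free: two points shared by two distinct members, or by a repeated
-- member, exhaust the degree 2 of both points and so are twins, and conversely the two members
-- through one of two twins (counted with multiplicity) both contain the other. Collapsing the twin
-- classes turns a cover of [n] with m classes into a twin-free cover of [m], and keeps properness,
-- so s_n = Σ_m S(n,m) u_m and t_n = Σ_m S(n,m) v_m. In a restricted cover a repeated member is a
-- singleton, so the only obstructions to properness are doubled singletons {x},{x}; deleting their
-- points gives u_n = Σ_k C(n,k) v_k. Both sums are obtained by adding one point p at a time: either
-- p is the twin of the least element of some class, or it is isolated (the Stirling recurrence);
-- either {p} is doubled or not (Pascal's rule). Finally [xⁿ](eˣ − 1)ᵏ = k! S(n,k) / n!.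

module Submission where

open import Defs

import Algebra.Properties.CommutativeSemigroup as CommutativeSemigroupProperties
open import Axiom.UniquenessOfIdentityProofs using (module Decidable⇒UIP)
open import Data.Bool using (Bool; true; false; T; if_then_else_; _∧_; not)
open import Data.Bool.ListAction using (all)
open import Data.Bool.Properties using (T?; T-≡; ∧-assoc; ∧-comm; ∧-identityʳ; ∧-zeroʳ) renaming (_≟_ to _≟ᵇ_)
open import Data.Empty using (⊥-elim)
open import Data.Fin using (Fin; toℕ; fromℕ<; punchIn; punchOut) renaming (zero to fz; suc to fs)
open import Data.Fin.Properties
  using (toℕ-injective; toℕ-fromℕ<; toℕ<n; punchInᵢ≢i; punchIn-injective; punchIn-punchOut) renaming (_≟_ to _≟ᶠ_)
import Data.Fin.Properties as Finₚ
open import Data.Fin.Subset using (Subset; ∣_∣; _∩_; ⁅_⁆) renaming (⊥ to ∅)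
open import Data.Fin.Subset.Properties using (∣⊥∣≡0)
import Data.Integer as ℤ
open import Data.Integer.Properties using (pos-*; pos-+)
open import Data.List using (List; []; _∷_; map; length; filter; concatMap; allFin; _++_)
open import Data.List.Membership.Propositional using (_∈_)
open import Data.List.Membership.Propositional.Properties using (∈-allFin; ∈-concatMap⁺)
open import Data.List.Properties using (map-tabulate; length-tabulate)
import Data.List.Relation.Unary.All as All
open import Data.List.Relation.Unary.All.Properties using (all⁺; all⁻)
open import Data.List.Relation.Unary.Any using (here; there)
import Data.List.Relation.Unary.Any as Any
open import Data.Maybe using (Maybe; just; nothing; is-just)
import Data.Maybe as Maybe
open import Data.Nat using (ℕ; zero; suc; pred; _+_; _*_; _∸_; _≤_; _<_; z≤n; s≤s; _≤ᵇ_; _≡ᵇ_; _<?_; _≤?_; _!; NonZero)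
open import Data.Nat.Combinatorics
  using (nCk+nC[k+1]≡[n+1]C[k+1]; k>n⇒nCk≡0; nCk≡n!/k![n-k]!; k![n∸k]!∣n!; nCk≡nC[n∸k]; nCn≡1) renaming (_C_ to _choose_)
open import Data.Nat.DivMod using (m/n*n≡m)
open import Data.Nat.ListAction using (sum)
open import Data.Nat.Properties
import Data.Nat.Properties as ℕₚ
open import Data.Nat.Solver using (module +-*-Solver)
open import Data.Product using (_×_; _,_; proj₁; proj₂; ∃; uncurry)
open import Data.Product.Properties using (,-injective)
open import Data.Rational using (ℚ; 0ℚ; _/_; toℚᵘ) renaming (_+_ to _+ℚ_; _*_ to _*ℚ_)
import Data.Rational.Properties as ℚₚ
open import Data.Rational.Properties using (toℚᵘ-injective; toℚᵘ-fromℚᵘ; toℚᵘ-homo-+; toℚᵘ-homo-*)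
open import Data.Rational.Unnormalised using (mkℚᵘ; *≡*) renaming (_+_ to _+ᵘ_; _*_ to _*ᵘ_; _≃_ to _≃ᵘ_; _/_ to _/ᵘ_)
open import Data.Rational.Unnormalised.Properties using ()
  renaming (≃-trans to ≃ᵘ-trans; ≃-sym to ≃ᵘ-sym; ≃-reflexive to ≃ᵘ-reflexive; +-cong to +ᵘ-cong; *-cong to *ᵘ-cong)
open import Data.Sum using (_⊎_; inj₁; inj₂)
open import Data.Vec using (Vec; []; _∷_; lookup; insertAt; removeAt)
import Data.Vec.Properties as Vec
open import Data.Vec.Properties using (tabulate∘lookup; tabulate-cong)
open import Function using (_∘_; _$_; id; case_of_)
open import Function.Bundles using (Equivalence; _⇔_; mk⇔)
open import Relation.Binary.Definitions using (DecidableEquality; tri<; tri≈; tri>)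
open import Relation.Binary.PropositionalEquality
open import Relation.Nullary using (¬_; yes; no; does; Dec; ¬?)
open import Relation.Nullary.Decidable using (map′; _×-dec_; _→-dec_; dec-true; dec-false; does-⇔)

open +-*-Solver using (solve; _:=_; _:*_; con)
open CommutativeSemigroupProperties +-commutativeSemigroup using (x∙yz≈y∙xz; x∙yz≈xz∙y) renaming (interchange to +-interchange)
open CommutativeSemigroupProperties *-commutativeSemigroup using () renaming (x∙yz≈y∙xz to *-left-comm)

𝟙 : Bool → ℕ
𝟙 true = 1
𝟙 false = 0

𝟙-∧ : ∀ a b → 𝟙 (a ∧ b) ≡ 𝟙 a * 𝟙 b
𝟙-∧ true b = sym (+-identityʳ (𝟙 b))
𝟙-∧ false b = refl

𝟙-split : ∀ a b → 𝟙 a ≡ 𝟙 (a ∧ b) + 𝟙 (a ∧ not b)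
𝟙-split true true = refl
𝟙-split true false = refl
𝟙-split false b = refl

T⇒≡true : ∀ {b} → T b → b ≡ true
T⇒≡true = Equivalence.to T-≡

≡true⇒T : ∀ {b} → b ≡ true → T b
≡true⇒T = Equivalence.from T-≡

∧-≡true⇒ : ∀ {a b} → (a ∧ b) ≡ true → a ≡ true × b ≡ true
∧-≡true⇒ {true} {true} _ = refl , refl

∧-≡true⇐ : ∀ {a b} → a ≡ true → b ≡ true → (a ∧ b) ≡ true
∧-≡true⇐ refl refl = refl

∧₃-≡true⇒ : ∀ {a b c} → (a ∧ b ∧ c) ≡ true → a ≡ true × b ≡ true × c ≡ true
∧₃-≡true⇒ {true} {true} {true} _ = refl , refl , refl

∧₃-≡true⇐ : ∀ {a b c} → a ≡ true → b ≡ true → c ≡ true → (a ∧ b ∧ c) ≡ true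
∧₃-≡true⇐ refl refl refl = refl

≢true⇒≡false : ∀ {b} → ¬ b ≡ true → b ≡ false
≢true⇒≡false {true} ¬b = ⊥-elim (¬b refl)
≢true⇒≡false {false} _ = refl

not-≡true : ∀ {b} → not b ≡ true → b ≡ false
not-≡true {false} _ = refl

true≢false : true ≢ false
true≢false ()

bool-ext : ∀ {a b} → (a ≡ true → b ≡ true) → (b ≡ true → a ≡ true) → a ≡ b
bool-ext {true} a⇒b _ = sym (a⇒b refl)
bool-ext {false} {true} _ b⇒a = b⇒a refl
bool-ext {false} {false} _ _ = refl

does⇒ : ∀ {A : Set} (a? : Dec A) → does a? ≡ true → A
does⇒ (yes a) _ = a

≡ᵇ-sound : ∀ {m n} → (m ≡ᵇ n) ≡ true → m ≡ n
≡ᵇ-sound {m} {n} e = ≡ᵇ⇒≡ m n (≡true⇒T e)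

≡ᵇ-complete : ∀ {m n} → m ≡ n → (m ≡ᵇ n) ≡ true
≡ᵇ-complete {m} {n} e = T⇒≡true (≡⇒≡ᵇ m n e)

≤ᵇ-sound : ∀ {m n} → (m ≤ᵇ n) ≡ true → m ≤ n
≤ᵇ-sound {m} {n} e = ≤ᵇ⇒≤ m n (≡true⇒T e)

≤ᵇ-complete : ∀ {m n} → m ≤ n → (m ≤ᵇ n) ≡ true
≤ᵇ-complete m≤n = T⇒≡true (≤⇒≤ᵇ m≤n)

fromJust : ∀ {A : Set} (x : Maybe A) → is-just x ≡ true → A
fromJust (just a) _ = a

fromJust-≡ : ∀ {A : Set} (x : Maybe A) (h : is-just x ≡ true) → x ≡ just (fromJust x h)
fromJust-≡ (just a) _ = refl

fromJust-just : ∀ {A : Set} {x : Maybe A} {a} (h : is-just x ≡ true) → x ≡ just a → fromJust x h ≡ a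
fromJust-just _ refl = refl

is-just≡false : ∀ {A : Set} (x : Maybe A) → is-just x ≡ false → x ≡ nothing
is-just≡false nothing _ = refl

module _ {A : Set} {xs : List A} (∈xs : ∀ x → x ∈ xs) (p : A → Bool) where

  all≡true⇒ : all p xs ≡ true → ∀ x → p x ≡ true
  all≡true⇒ all-p x = T⇒≡true (All.lookup (all⁺ p xs (≡true⇒T all-p)) (∈xs x))

  all≡true⇐ : (∀ x → p x ≡ true) → all p xs ≡ true
  all≡true⇐ p-holds = T⇒≡true (all⁻ p {xs} (All.tabulate λ {x} _ → ≡true⇒T (p-holds x)))

∑ : {A : Set} → List A → (A → ℕ) → ℕ
∑ xs f = sum (map f xs)

module _ {A : Set} where

  ∑-cong : (xs : List A) {f g : A → ℕ} → (∀ x → f x ≡ g x) → ∑ xs f ≡ ∑ xs g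
  ∑-cong [] e = refl
  ∑-cong (x ∷ xs) e = cong₂ _+_ (e x) (∑-cong xs e)

  ∑-zero : (xs : List A) {f : A → ℕ} → (∀ x → f x ≡ 0) → ∑ xs f ≡ 0
  ∑-zero [] e = refl
  ∑-zero (x ∷ xs) e = cong₂ _+_ (e x) (∑-zero xs e)

  ∑-distrib-+ : (xs : List A) (f g : A → ℕ) → ∑ xs (λ x → f x + g x) ≡ ∑ xs f + ∑ xs g
  ∑-distrib-+ [] f g = refl
  ∑-distrib-+ (x ∷ xs) f g =
    trans (cong (f x + g x +_) (∑-distrib-+ xs f g)) (+-interchange (f x) (g x) (∑ xs f) (∑ xs g))

  ∑-distribˡ-* : (xs : List A) (c : ℕ) (f : A → ℕ) → ∑ xs (λ x → c * f x) ≡ c * ∑ xs f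
  ∑-distribˡ-* [] c f = sym (*-zeroʳ c)
  ∑-distribˡ-* (x ∷ xs) c f =
    trans (cong (c * f x +_) (∑-distribˡ-* xs c f)) (sym (*-distribˡ-+ c (f x) (∑ xs f)))

  ∑-++ : (xs ys : List A) (f : A → ℕ) → ∑ (xs ++ ys) f ≡ ∑ xs f + ∑ ys f
  ∑-++ [] ys f = refl
  ∑-++ (x ∷ xs) ys f = trans (cong (f x +_) (∑-++ xs ys f)) (sym (+-assoc (f x) _ _))

  ∑-map : {B : Set} (xs : List B) (g : B → A) (f : A → ℕ) → ∑ (map g xs) f ≡ ∑ xs (f ∘ g)
  ∑-map [] g f = refl
  ∑-map (x ∷ xs) g f = cong (f (g x) +_) (∑-map xs g f)

  ∑-concatMap : {B : Set} (xs : List B) (g : B → List A) (f : A → ℕ) →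
                ∑ (concatMap g xs) f ≡ ∑ xs (λ x → ∑ (g x) f)
  ∑-concatMap [] g f = refl
  ∑-concatMap (x ∷ xs) g f =
    trans (∑-++ (g x) (concatMap g xs) f) (cong (∑ (g x) f +_) (∑-concatMap xs g f))

  ∑𝟙≤length : (xs : List A) (p : A → Bool) → ∑ xs (𝟙 ∘ p) ≤ length xs
  ∑𝟙≤length [] p = z≤n
  ∑𝟙≤length (x ∷ xs) p = +-mono-≤ (𝟙≤1 (p x)) (∑𝟙≤length xs p)
    where
    𝟙≤1 : ∀ b → 𝟙 b ≤ 1
    𝟙≤1 true = s≤s z≤n
    𝟙≤1 false = z≤n

  length-filter≡∑𝟙 : (xs : List A) (p : A → Bool) →
                     length (filter (λ x → T? (p x)) xs) ≡ ∑ xs (𝟙 ∘ p)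
  length-filter≡∑𝟙 [] p = refl
  length-filter≡∑𝟙 (x ∷ xs) p with p x
  ... | true = cong suc (length-filter≡∑𝟙 xs p)
  ... | false = length-filter≡∑𝟙 xs p

  ∑-nonzero : (xs : List A) (f : A → ℕ) → ∑ xs f ≢ 0 → ∃ λ x → f x ≢ 0
  ∑-nonzero [] f ∑≢0 = ⊥-elim (∑≢0 refl)
  ∑-nonzero (x ∷ xs) f ∑≢0 with f x in fx
  ... | suc _ = x , λ fx≡0 → 1+n≢0 (trans (sym fx) fx≡0)
  ... | zero = ∑-nonzero xs f ∑≢0

∑-comm : {A B : Set} (xs : List A) (ys : List B) (F : A → B → ℕ) →
         ∑ xs (λ x → ∑ ys (F x)) ≡ ∑ ys (λ y → ∑ xs (λ x → F x y))
∑-comm [] ys F = sym (∑-zero ys (λ _ → refl))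
∑-comm (x ∷ xs) ys F =
  trans (cong (∑ ys (F x) +_) (∑-comm xs ys F)) (sym (∑-distrib-+ ys (F x) _))

∑-allFin-suc : ∀ n (f : Fin (suc n) → ℕ) → ∑ (allFin (suc n)) f ≡ f fz + ∑ (allFin n) (f ∘ fs)
∑-allFin-suc n f =
  cong (λ ys → f fz + sum ys) (trans (map-tabulate fs f) (sym (map-tabulate id (f ∘ fs))))

∑-allFin-punchIn : ∀ n (p : Fin (suc n)) (f : Fin (suc n) → ℕ) →
                   ∑ (allFin (suc n)) f ≡ f p + ∑ (allFin n) (f ∘ punchIn p)
∑-allFin-punchIn n fz f = ∑-allFin-suc n f
∑-allFin-punchIn (suc n) (fs p) f = begin
  ∑ (allFin (suc (suc n))) f
    ≡⟨ ∑-allFin-suc (suc n) f ⟩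
  f fz + ∑ (allFin (suc n)) (f ∘ fs)
    ≡⟨ cong (f fz +_) (∑-allFin-punchIn n p (f ∘ fs)) ⟩
  f fz + (f (fs p) + ∑ (allFin n) (f ∘ fs ∘ punchIn p))
    ≡⟨ x∙yz≈y∙xz (f fz) (f (fs p)) _ ⟩
  f (fs p) + (f fz + ∑ (allFin n) (f ∘ fs ∘ punchIn p))
    ≡⟨ cong (f (fs p) +_) (sym (∑-allFin-suc n (f ∘ punchIn (fs p)))) ⟩
  f (fs p) + ∑ (allFin (suc n)) (f ∘ punchIn (fs p)) ∎
  where open ≡-Reasoning

∑≤ : ℕ → (ℕ → ℕ) → ℕ
∑≤ zero f = f 0
∑≤ (suc n) f = ∑≤ n f + f (suc n)

∑≤-cong : ∀ n {f g : ℕ → ℕ} → (∀ k → k ≤ n → f k ≡ g k) → ∑≤ n f ≡ ∑≤ n g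
∑≤-cong zero f≡g = f≡g 0 z≤n
∑≤-cong (suc n) f≡g = cong₂ _+_ (∑≤-cong n (λ k k≤n → f≡g k (m≤n⇒m≤1+n k≤n))) (f≡g (suc n) ≤-refl)

∑≤-zero : ∀ n {f : ℕ → ℕ} → (∀ k → k ≤ n → f k ≡ 0) → ∑≤ n f ≡ 0
∑≤-zero n f≡0 = trans (∑≤-cong n f≡0) (zeros n)
  where
  zeros : ∀ n → ∑≤ n (λ _ → 0) ≡ 0
  zeros zero = refl
  zeros (suc n) = cong (_+ 0) (zeros n)

∑≤-distrib-+ : ∀ n (f g : ℕ → ℕ) → ∑≤ n (λ k → f k + g k) ≡ ∑≤ n f + ∑≤ n g
∑≤-distrib-+ zero f g = refl
∑≤-distrib-+ (suc n) f g =
  trans (cong (_+ (f (suc n) + g (suc n))) (∑≤-distrib-+ n f g)) (+-interchange (∑≤ n f) (∑≤ n g) (f (suc n)) (g (suc n)))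

∑≤-distribˡ-* : ∀ n c (f : ℕ → ℕ) → ∑≤ n (λ k → c * f k) ≡ c * ∑≤ n f
∑≤-distribˡ-* zero c f = refl
∑≤-distribˡ-* (suc n) c f = trans (cong (_+ c * f (suc n)) (∑≤-distribˡ-* n c f)) (sym (*-distribˡ-+ c _ _))

∑≤-∑-comm : ∀ {A : Set} n (xs : List A) (F : ℕ → A → ℕ) →
            ∑≤ n (λ k → ∑ xs (F k)) ≡ ∑ xs (λ x → ∑≤ n (λ k → F k x))
∑≤-∑-comm zero xs F = refl
∑≤-∑-comm (suc n) xs F = trans (cong (_+ ∑ xs (F (suc n))) (∑≤-∑-comm n xs F)) (sym (∑-distrib-+ xs _ _))

∑≤-indicator : ∀ n k → k ≤ n → ∑≤ n (λ m → 𝟙 (does (k ℕₚ.≟ m))) ≡ 1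
∑≤-indicator zero zero _ = refl
∑≤-indicator (suc n) k k≤1+n with k ℕₚ.≟ suc n
... | yes refl = cong₂ _+_ (∑≤-zero n (λ m m≤n → cong 𝟙 (dec-false (suc n ℕₚ.≟ m) λ { refl → 1+n≰n m≤n })))
                          (cong 𝟙 (dec-true (suc n ℕₚ.≟ suc n) refl))
... | no k≢1+n = trans (cong₂ _+_ (∑≤-indicator n k (≤-pred (≤∧≢⇒< k≤1+n k≢1+n)))
                                  (cong 𝟙 (dec-false (k ℕₚ.≟ suc n) k≢1+n)))
                      (+-identityʳ 1)

∑≤-shift : ∀ n (f : ℕ → ℕ) → ∑≤ (suc n) f ≡ f 0 + ∑≤ n (f ∘ suc)
∑≤-shift zero f = refl
∑≤-shift (suc n) f = trans (cong (_+ f (suc (suc n))) (∑≤-shift n f)) (+-assoc (f 0) _ _)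

∑≤-reverse : ∀ n (f : ℕ → ℕ) → ∑≤ n f ≡ ∑≤ n (λ i → f (n ∸ i))
∑≤-reverse zero f = refl
∑≤-reverse (suc n) f = begin
  ∑≤ (suc n) f
    ≡⟨ ∑≤-shift n f ⟩
  f 0 + ∑≤ n (f ∘ suc)
    ≡⟨ cong (f 0 +_) (∑≤-reverse n (f ∘ suc)) ⟩
  f 0 + ∑≤ n (λ i → f (suc (n ∸ i)))
    ≡⟨ cong (f 0 +_) (∑≤-cong n λ i i≤n → cong f (sym (+-∸-assoc 1 i≤n))) ⟩
  f 0 + ∑≤ n (λ i → f (suc n ∸ i))
    ≡⟨ +-comm (f 0) _ ⟩
  ∑≤ n (λ i → f (suc n ∸ i)) + f 0
    ≡⟨ cong (λ k → ∑≤ n (λ i → f (suc n ∸ i)) + f k) (sym (n∸n≡0 n)) ⟩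
  ∑≤ (suc n) (λ i → f (suc n ∸ i)) ∎
  where open ≡-Reasoning

∑≤-pascal : ∀ n (f : ℕ → ℕ) →
            ∑≤ (suc n) (λ k → (suc n choose k) * f k)
            ≡ ∑≤ n (λ k → (n choose k) * f k) + ∑≤ n (λ k → (n choose k) * f (suc k))
∑≤-pascal n f = begin
  ∑≤ (suc n) (λ k → (suc n choose k) * f k)
    ≡⟨ ∑≤-shift n _ ⟩
  f 0 + 0 + ∑≤ n (λ k → (suc n choose suc k) * f (suc k))
    ≡⟨ cong (f 0 + 0 +_) (∑≤-cong n λ k _ → trans (cong (_* f (suc k)) (sym (nCk+nC[k+1]≡[n+1]C[k+1] n k)))
                                                 (*-distribʳ-+ (f (suc k)) (n choose k) (n choose suc k))) ⟩
  f 0 + 0 + ∑≤ n (λ k → (n choose k) * f (suc k) + (n choose suc k) * f (suc k))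
    ≡⟨ cong (f 0 + 0 +_) (∑≤-distrib-+ n _ _) ⟩
  f 0 + 0 + (∑≤ n (λ k → (n choose k) * f (suc k)) + ∑≤ n (λ k → (n choose suc k) * f (suc k)))
    ≡⟨ x∙yz≈xz∙y (f 0 + 0) _ _ ⟩
  f 0 + 0 + ∑≤ n (λ k → (n choose suc k) * f (suc k)) + ∑≤ n (λ k → (n choose k) * f (suc k))
    ≡⟨ cong (_+ ∑≤ n (λ k → (n choose k) * f (suc k))) (sym drop-top) ⟩
  ∑≤ n (λ k → (n choose k) * f k) + ∑≤ n (λ k → (n choose k) * f (suc k)) ∎
  where
  open ≡-Reasoning
  drop-top : ∑≤ n (λ k → (n choose k) * f k) ≡ f 0 + 0 + ∑≤ n (λ k → (n choose suc k) * f (suc k))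
  drop-top = trans (sym (trans (cong (λ c → ∑≤ n (λ k → (n choose k) * f k) + c * f (suc n)) (k>n⇒nCk≡0 (n<1+n n)))
                               (+-identityʳ _)))
                   (∑≤-shift n (λ k → (n choose k) * f k))

-- Counting by enumeration and by correspondence

record Enumerates {A : Set} (xs : List A) (_≟_ : DecidableEquality A) (inA : A → Bool) : Set where
  constructor enumerates
  field occurrences : ∀ a → ∑ xs (λ x → 𝟙 (does (x ≟ a))) ≡ 𝟙 (inA a)

open Enumerates

_×-≟_ : {A B : Set} → DecidableEquality A → DecidableEquality B → DecidableEquality (A × B)
(_≟A_ ×-≟ _≟B_) (a , b) (a′ , b′) = map′ (uncurry (cong₂ _,_)) ,-injective (a ≟A a′ ×-dec b ≟B b′)

product-enumerates : {A B : Set} {xs : List A} {ys : List B} {_≟A_ : DecidableEquality A}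
  {_≟B_ : DecidableEquality B} {inA : A → Bool} {inB : B → Bool} →
  Enumerates xs _≟A_ inA → Enumerates ys _≟B_ inB →
  Enumerates (concatMap (λ a → map (a ,_) ys) xs) (_≟A_ ×-≟ _≟B_) (λ (a , b) → inA a ∧ inB b)
product-enumerates {xs = xs} {ys} {_≟A_} {_≟B_} {inA} {inB} enA enB = enumerates λ (a , b) → begin
  ∑ (concatMap (λ x → map (x ,_) ys) xs) (λ z → 𝟙 (does ((_≟A_ ×-≟ _≟B_) z (a , b))))
    ≡⟨ ∑-concatMap xs _ _ ⟩
  ∑ xs (λ x → ∑ (map (x ,_) ys) (λ z → 𝟙 (does ((_≟A_ ×-≟ _≟B_) z (a , b)))))
    ≡⟨ ∑-cong xs (λ x → trans (∑-map ys _ _) (∑-cong ys (λ y → 𝟙-∧ (does (x ≟A a)) (does (y ≟B b))))) ⟩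
  ∑ xs (λ x → ∑ ys (λ y → 𝟙 (does (x ≟A a)) * 𝟙 (does (y ≟B b))))
    ≡⟨ ∑-cong xs (λ x → trans (∑-distribˡ-* ys (𝟙 (does (x ≟A a))) _)
                               (cong (𝟙 (does (x ≟A a)) *_) (occurrences enB b))) ⟩
  ∑ xs (λ x → 𝟙 (does (x ≟A a)) * 𝟙 (inB b))
    ≡⟨ ∑-cong xs (λ x → *-comm (𝟙 (does (x ≟A a))) (𝟙 (inB b))) ⟩
  ∑ xs (λ x → 𝟙 (inB b) * 𝟙 (does (x ≟A a)))
    ≡⟨ trans (∑-distribˡ-* xs (𝟙 (inB b)) _) (cong (𝟙 (inB b) *_) (occurrences enA a)) ⟩
  𝟙 (inB b) * 𝟙 (inA a)
    ≡⟨ trans (*-comm (𝟙 (inB b)) (𝟙 (inA a))) (sym (𝟙-∧ (inA a) (inB b))) ⟩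
  𝟙 (inA a ∧ inB b) ∎
  where open ≡-Reasoning

allFin-enumerates : ∀ n → Enumerates (allFin n) _≟ᶠ_ (λ _ → true)
allFin-enumerates n = enumerates (occurs n)
  where
  occurs : ∀ n a → ∑ (allFin n) (λ x → 𝟙 (does (x ≟ᶠ a))) ≡ 1
  occurs (suc n) fz =
    trans (∑-allFin-suc n (λ x → 𝟙 (does (x ≟ᶠ fz))))   (cong suc (∑-zero (allFin n) (λ _ → refl)))
  occurs (suc n) (fs a) =
    trans (∑-allFin-suc n (λ x → 𝟙 (does (x ≟ᶠ fs a)))) (occurs n a)

module _ {A : Set} {xs : List A} {_≟_ : DecidableEquality A} (all-xs : Enumerates xs _≟_ (λ _ → true)) where

  ∑-extract : ∀ (F : A → ℕ) a → ∑ xs F ≡ F a + ∑ xs (λ x → if does (x ≟ a) then 0 else F x)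
  ∑-extract F a = begin
    ∑ xs F
      ≡⟨ ∑-cong xs split ⟩
    ∑ xs (λ x → F a * 𝟙 (does (x ≟ a)) + others x)
      ≡⟨ ∑-distrib-+ xs _ others ⟩
    ∑ xs (λ x → F a * 𝟙 (does (x ≟ a))) + ∑ xs others
      ≡⟨ cong (_+ ∑ xs others) (∑-distribˡ-* xs (F a) _) ⟩
    F a * ∑ xs (λ x → 𝟙 (does (x ≟ a))) + ∑ xs others
      ≡⟨ cong (λ k → F a * k + ∑ xs others) (occurrences all-xs a) ⟩
    F a * 1 + ∑ xs others
      ≡⟨ cong (_+ ∑ xs others) (*-identityʳ (F a)) ⟩
    F a + ∑ xs others ∎
    where
    open ≡-Reasoning
    others : A → ℕ
    others x = if does (x ≟ a) then 0 else F x
    split : ∀ x → F x ≡ F a * 𝟙 (does (x ≟ a)) + others x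
    split x with x ≟ a
    ... | yes refl = sym (trans (+-identityʳ _) (*-identityʳ (F x)))
    ... | no _ = sym (cong (_+ F x) (*-zeroʳ (F a)))

  term≤∑ : ∀ (F : A → ℕ) a → F a ≤ ∑ xs F
  term≤∑ F a = subst (F a ≤_) (sym (∑-extract F a)) (m≤m+n (F a) _)

  private
    others-≡ : ∀ (F : A → ℕ) a b → a ≢ b → (if does (b ≟ a) then 0 else F b) ≡ F b
    others-≡ F a b a≢b with b ≟ a
    ... | yes b≡a = ⊥-elim (a≢b (sym b≡a))
    ... | no _ = refl

  two-terms≤∑ : ∀ (F : A → ℕ) a b → a ≢ b → F a + F b ≤ ∑ xs F
  two-terms≤∑ F a b a≢b = subst (F a + F b ≤_) (sym (∑-extract F a))
    (+-monoʳ-≤ (F a) (≤-trans (≤-reflexive (sym (others-≡ F a b a≢b)))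
                              (term≤∑ (λ x → if does (x ≟ a) then 0 else F x) b)))

  three-terms≤∑ : ∀ (F : A → ℕ) a b c → a ≢ b → a ≢ c → b ≢ c → F a + (F b + F c) ≤ ∑ xs F
  three-terms≤∑ F a b c a≢b a≢c b≢c = subst (F a + (F b + F c) ≤_) (sym (∑-extract F a))
    (+-monoʳ-≤ (F a) (≤-trans (≤-reflexive (sym (cong₂ _+_ (others-≡ F a b a≢b) (others-≡ F a c a≢c))))
      (two-terms≤∑ (λ x → if does (x ≟ a) then 0 else F x) b c b≢c)))

  ∑≡2⇒ : ∀ (F : A → ℕ) → ∑ xs F ≡ 2 →
         (∃ λ a → 2 ≤ F a) ⊎ (∃ λ a → ∃ λ b → a ≢ b × 1 ≤ F a × 1 ≤ F b)
  ∑≡2⇒ F ∑≡2 with ∑-nonzero xs F (λ ∑≡0 → 1+n≢0 (trans (sym ∑≡2) ∑≡0))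
  ... | a , Fa≢0 with 2 ≤? F a
  ...   | yes 2≤Fa = inj₁ (a , 2≤Fa)
  ...   | no 2≰Fa with ∑-nonzero xs others (λ ∑≡0 → 1+n≢0 (trans (sym ∑others≡1) ∑≡0))
    where
    others : A → ℕ
    others x = if does (x ≟ a) then 0 else F x
    Fa≡1 : F a ≡ 1
    Fa≡1 = ≤-antisym (≤-pred (≰⇒> 2≰Fa)) (n≢0⇒n>0 Fa≢0)
    ∑others≡1 : ∑ xs others ≡ 1
    ∑others≡1 = +-cancelˡ-≡ 1 _ _ (trans (cong (_+ ∑ xs others) (sym Fa≡1)) (trans (sym (∑-extract F a)) ∑≡2))
  ...     | b , others-b≢0 with b ≟ a
  ...       | yes _ = ⊥-elim (others-b≢0 refl)
  ...       | no b≢a = inj₂ (a , b , b≢a ∘ sym , n≢0⇒n>0 Fa≢0 , n≢0⇒n>0 others-b≢0)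

record Correspondence {A B : Set} (p : A → Bool) (q : B → Bool) : Set where
  field
    to      : ∀ a → p a ≡ true → B
    from    : B → A
    to-q    : ∀ a pa → q (to a pa) ≡ true
    from-to : ∀ a pa → from (to a pa) ≡ a
    from-p  : ∀ b → q b ≡ true → p (from b) ≡ true
    to-from : ∀ b qb → to (from b) (from-p b qb) ≡ b

  to-cong : ∀ {a a′} (pa : p a ≡ true) (pa′ : p a′ ≡ true) → a ≡ a′ → to a pa ≡ to a′ pa′
  to-cong pa pa′ refl = cong (to _) (Decidable⇒UIP.≡-irrelevant _≟ᵇ_ pa pa′)

module _ {A B : Set} {xs : List A} {ys : List B} {_≟A_ : DecidableEquality A} {_≟B_ : DecidableEquality B}
         {inA : A → Bool} {inB : B → Bool} (enA : Enumerates xs _≟A_ inA) (enB : Enumerates ys _≟B_ inB)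
         {p : A → Bool} {q : B → Bool}
         (p⇒inA : ∀ a → p a ≡ true → inA a ≡ true) (q⇒inB : ∀ b → q b ≡ true → inB b ≡ true)
         (φ : Correspondence p q) where

  open Correspondence φ

  private
    incidence : A → B → ℕ
    incidence a b = 𝟙 (q b ∧ does (a ≟A from b))

    incidence-to : ∀ a (pa : p a ≡ true) b → incidence a b ≡ 𝟙 (does (b ≟B to a pa))
    incidence-to a pa b with b ≟B to a pa
    ... | yes refl rewrite to-q a pa | from-to a pa with a ≟A a
    ...   | yes _ = refl
    ...   | no a≢a = ⊥-elim (a≢a refl)
    incidence-to a pa b | no b≢to with q b in qb | a ≟A from b
    ... | false | _ = refl
    ... | true | no _ = refl
    ... | true | yes a≡from = ⊥-elim (b≢to (sym (trans (to-cong pa (from-p b qb) a≡from) (to-from b qb))))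

    incidence-¬p : ∀ a → p a ≡ false → ∀ b → incidence a b ≡ 0
    incidence-¬p a ¬pa b with q b in qb | a ≟A from b
    ... | false | _ = refl
    ... | true | no _ = refl
    ... | true | yes refl with trans (sym ¬pa) (from-p b qb)
    ... | ()

    row : ∀ a → ∑ ys (incidence a) ≡ 𝟙 (p a)
    row a with p a in pa
    ... | true = trans (∑-cong ys (incidence-to a pa)) (trans (occurrences enB (to a pa)) (cong 𝟙 (q⇒inB _ (to-q a pa))))
    ... | false = ∑-zero ys (incidence-¬p a pa)

    column : ∀ b → ∑ xs (λ a → incidence a b) ≡ 𝟙 (q b)
    column b with q b in qb
    ... | false = ∑-zero xs (λ _ → refl)
    ... | true = trans (occurrences enA (from b)) (cong 𝟙 (p⇒inA _ (from-p b qb)))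

  ∑𝟙-correspondence : ∑ xs (𝟙 ∘ p) ≡ ∑ ys (𝟙 ∘ q)
  ∑𝟙-correspondence = begin
    ∑ xs (𝟙 ∘ p)                               ≡⟨ ∑-cong xs (sym ∘ row) ⟩
    ∑ xs (λ a → ∑ ys (incidence a))            ≡⟨ ∑-comm xs ys incidence ⟩
    ∑ ys (λ b → ∑ xs (λ a → incidence a b))    ≡⟨ ∑-cong ys column ⟩
    ∑ ys (𝟙 ∘ q)                               ∎
    where open ≡-Reasoning

lookup-ext : ∀ {A : Set} {n} (u w : Vec A n) → (∀ i → lookup u i ≡ lookup w i) → u ≡ w
lookup-ext u w same = trans (sym (tabulate∘lookup u)) (trans (tabulate-cong same) (tabulate∘lookup w))

lookup-removeAt : ∀ {A : Set} {n} (S : Vec A (suc n)) (p : Fin (suc n)) (i : Fin n) →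
                  lookup (removeAt S p) i ≡ lookup S (punchIn p i)
lookup-removeAt (x ∷ S) fz i = refl
lookup-removeAt (x ∷ y ∷ S) (fs p) fz = refl
lookup-removeAt (x ∷ y ∷ S) (fs p) (fs i) = lookup-removeAt (y ∷ S) p i

punchIn-or-pivot : ∀ {n} (p y : Fin (suc n)) → y ≡ p ⊎ ∃ λ x → y ≡ punchIn p x
punchIn-or-pivot p y with y ≟ᶠ p
... | yes y≡p = inj₁ y≡p
... | no y≢p = inj₂ (punchOut (y≢p ∘ sym) , sym (punchIn-punchOut (y≢p ∘ sym)))

toℕ-punchIn-< : ∀ {N} (p : Fin (suc N)) x → toℕ x < toℕ p → toℕ (punchIn p x) ≡ toℕ x
toℕ-punchIn-< (fs p) fz _ = refl
toℕ-punchIn-< (fs p) (fs x) (s≤s x<p) = cong suc (toℕ-punchIn-< p x x<p)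

toℕ-punchIn-≥ : ∀ {N} (p : Fin (suc N)) x → toℕ p ≤ toℕ x → toℕ (punchIn p x) ≡ suc (toℕ x)
toℕ-punchIn-≥ fz x _ = refl
toℕ-punchIn-≥ (fs p) (fs x) (s≤s p≤x) = cong suc (toℕ-punchIn-≥ p x p≤x)

pivot≤punchIn⇔ : ∀ {N} (p : Fin (suc N)) x → toℕ p ≤ toℕ (punchIn p x) ⇔ toℕ p ≤ toℕ x
pivot≤punchIn⇔ p x with toℕ x <? toℕ p
... | yes x<p rewrite toℕ-punchIn-< p x x<p = mk⇔ id id
... | no x≮p = mk⇔ (λ _ → ≮⇒≥ x≮p)
                  (λ p≤x → subst (toℕ p ≤_) (sym (toℕ-punchIn-≥ p x p≤x)) (m≤n⇒m≤1+n p≤x))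

punchIn<pivot⇒ : ∀ {N} (p : Fin (suc N)) x → toℕ (punchIn p x) < toℕ p → toℕ x < toℕ p
punchIn<pivot⇒ p x px<p = ≰⇒> λ p≤x → <⇒≱ px<p (Equivalence.from (pivot≤punchIn⇔ p x) p≤x)

punchIn-mono-< : ∀ {N} (p : Fin (suc N)) x y → toℕ x < toℕ y → toℕ (punchIn p x) < toℕ (punchIn p y)
punchIn-mono-< p x y x<y = ≰⇒> λ py≤px → <⇒≱ x<y (Finₚ.punchIn-cancel-≤ p y x py≤px)

punchIn-cancel-< : ∀ {N} (p : Fin (suc N)) x y → toℕ (punchIn p x) < toℕ (punchIn p y) → toℕ x < toℕ y
punchIn-cancel-< p x y px<py = ≰⇒> λ y≤x → <⇒≱ px<py (Finₚ.punchIn-mono-≤ p y x y≤x)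

least : ∀ {N} {P : Fin N → Set} → (∀ x → Dec (P x)) → Maybe (Fin N)
least {zero} P? = nothing
least {suc N} P? with P? fz
... | yes _ = just fz
... | no _ = Maybe.map fs (least (P? ∘ fs))

least-just : ∀ {N} {P : Fin N → Set} (P? : ∀ x → Dec (P x)) {x} → least P? ≡ just x →
             P x × (∀ y → toℕ y < toℕ x → ¬ P y)
least-just {suc N} P? eq with P? fz
least-just {suc N} P? refl | yes P0 = P0 , λ _ ()
... | no ¬P0 with least (P? ∘ fs) in rest
least-just {suc N} P? refl | no ¬P0 | just y with least-just (P? ∘ fs) rest
... | Py , below = Py , λ { fz _ → ¬P0 ; (fs z) (s≤s z<y) → below z z<y }

least-nothing : ∀ {N} {P : Fin N → Set} (P? : ∀ x → Dec (P x)) → least P? ≡ nothing → ∀ y → ¬ P y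
least-nothing {suc N} P? eq y with P? fz
least-nothing {suc N} P? () y | yes _
... | no ¬P0 with least (P? ∘ fs) in rest
least-nothing {suc N} P? () y | no ¬P0 | just _
least-nothing {suc N} P? refl fz | no ¬P0 | nothing = ¬P0
least-nothing {suc N} P? refl (fs y) | no ¬P0 | nothing = least-nothing (P? ∘ fs) rest y

least-char : ∀ {N} {P : Fin N → Set} (P? : ∀ x → Dec (P x)) {x} → P x → (∀ y → toℕ y < toℕ x → ¬ P y) →
             least P? ≡ just x
least-char {suc N} P? {fz} Px below with P? fz
... | yes _ = refl
... | no ¬P0 = ⊥-elim (¬P0 Px)
least-char {suc N} P? {fs x} Px below with P? fz
... | yes P0 = ⊥-elim (below fz (s≤s z≤n) P0)
... | no _ rewrite least-char (P? ∘ fs) Px (λ y y<x → below (fs y) (s≤s y<x)) = refl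

_≟ˢ_ : ∀ {n} → DecidableEquality (Subset n)
_≟ˢ_ = Vec.≡-dec _≟ᵇ_

==ˢ≡does≟ˢ : ∀ {n} (S T : Subset n) → (S ==ˢ T) ≡ does (S ≟ˢ T)
==ˢ≡does≟ˢ [] [] = refl
==ˢ≡does≟ˢ (false ∷ S) (false ∷ T) = ==ˢ≡does≟ˢ S T
==ˢ≡does≟ˢ (true ∷ S) (true ∷ T) = ==ˢ≡does≟ˢ S T
==ˢ≡does≟ˢ (false ∷ S) (true ∷ T) = refl
==ˢ≡does≟ˢ (true ∷ S) (false ∷ T) = refl

∈-allSubsets : ∀ {n} (S : Subset n) → S ∈ allSubsets n
∈-allSubsets [] = here refl
∈-allSubsets (false ∷ S) = ∈-concatMap⁺ _ (Any.map (λ { refl → here refl }) (∈-allSubsets S))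
∈-allSubsets (true ∷ S) = ∈-concatMap⁺ _ (Any.map (λ { refl → there (here refl) }) (∈-allSubsets S))

∀-subset? : ∀ {n} {P : Subset n → Set} → (∀ S → Dec (P S)) → Dec (∀ S → P S)
∀-subset? {n} P? = map′ (λ all-P S → All.lookup all-P (∈-allSubsets S)) (λ ∀P → All.tabulate (λ {S} _ → ∀P S))
                        (All.all? P? (allSubsets n))

∑-allSubsets-suc : ∀ n (F : Subset (suc n) → ℕ) →
                   ∑ (allSubsets (suc n)) F ≡ ∑ (allSubsets n) (λ S → F (false ∷ S) + F (true ∷ S))
∑-allSubsets-suc n F =
  trans (∑-concatMap (allSubsets n) _ F) (∑-cong (allSubsets n) (λ S → cong (F (false ∷ S) +_) (+-identityʳ _)))

∑-allSubsets-insertAt : ∀ n (p : Fin (suc n)) (F : Subset (suc n) → ℕ) →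
  ∑ (allSubsets (suc n)) F ≡ ∑ (allSubsets n) (λ T → F (insertAt T p false) + F (insertAt T p true))
∑-allSubsets-insertAt n fz F = ∑-allSubsets-suc n F
∑-allSubsets-insertAt (suc n) (fs p) F = begin
  ∑ (allSubsets (suc (suc n))) F
    ≡⟨ ∑-allSubsets-suc (suc n) F ⟩
  ∑ (allSubsets (suc n)) (λ S → F (false ∷ S) + F (true ∷ S))
    ≡⟨ ∑-distrib-+ (allSubsets (suc n)) (λ S → F (false ∷ S)) (λ S → F (true ∷ S)) ⟩
  ∑ (allSubsets (suc n)) (λ S → F (false ∷ S)) + ∑ (allSubsets (suc n)) (λ S → F (true ∷ S))
    ≡⟨ cong₂ _+_ (∑-allSubsets-insertAt n p (λ S → F (false ∷ S))) (∑-allSubsets-insertAt n p (λ S → F (true ∷ S))) ⟩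
  ∑ (allSubsets n) (λ T → F (false ∷ insertAt T p false) + F (false ∷ insertAt T p true))
    + ∑ (allSubsets n) (λ T → F (true ∷ insertAt T p false) + F (true ∷ insertAt T p true))
    ≡⟨ sym (∑-distrib-+ (allSubsets n) _ _) ⟩
  ∑ (allSubsets n) (λ T → F (false ∷ insertAt T p false) + F (false ∷ insertAt T p true)
                         + (F (true ∷ insertAt T p false) + F (true ∷ insertAt T p true)))
    ≡⟨ sym (∑-allSubsets-suc n _) ⟩
  ∑ (allSubsets (suc n)) (λ T → F (insertAt T (fs p) false) + F (insertAt T (fs p) true)) ∎
  where open ≡-Reasoning

allSubsets-enumerates : ∀ n → Enumerates (allSubsets n) _≟ˢ_ (λ _ → true)
allSubsets-enumerates n = enumerates (occurs n)
  where
  occurs : ∀ n T → ∑ (allSubsets n) (λ S → 𝟙 (does (S ≟ˢ T))) ≡ 1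
  occurs zero [] = refl
  occurs (suc n) (b ∷ T) =
    trans (∑-allSubsets-suc n _) (trans (∑-cong (allSubsets n) (split b)) (occurs n T))
    where
    split : ∀ b S → 𝟙 (does ((false ∷ S) ≟ˢ (b ∷ T))) + 𝟙 (does ((true ∷ S) ≟ˢ (b ∷ T))) ≡ 𝟙 (does (S ≟ˢ T))
    split false S = +-identityʳ _
    split true S = refl

_∋_ : ∀ {n} → Subset n → Fin n → Set
S ∋ x = lookup S x ≡ true

AtMostOnePoint : ∀ {n} → Subset n → Set
AtMostOnePoint S = ∀ x y → S ∋ x → S ∋ y → x ≡ y

lookup-∅ : ∀ {n} (i : Fin n) → lookup ∅ i ≡ false
lookup-∅ i = Vec.lookup-replicate i false

∅-unique : ∀ {n} (S : Subset n) → (∀ i → lookup S i ≡ false) → S ≡ ∅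
∅-unique S nothing-in-S = lookup-ext S ∅ (λ i → trans (nothing-in-S i) (sym (lookup-∅ i)))

∅-or-nonempty : ∀ {n} (S : Subset n) → S ≡ ∅ ⊎ ∃ λ i → S ∋ i
∅-or-nonempty [] = inj₁ refl
∅-or-nonempty (true ∷ S) = inj₂ (fz , refl)
∅-or-nonempty (false ∷ S) with ∅-or-nonempty S
... | inj₁ S≡∅ = inj₁ (cong (false ∷_) S≡∅)
... | inj₂ (i , i∈S) = inj₂ (fs i , i∈S)

∣S∣≡0⇒S≡∅ : ∀ {n} (S : Subset n) → ∣ S ∣ ≡ 0 → S ≡ ∅
∣S∣≡0⇒S≡∅ [] _ = refl
∣S∣≡0⇒S≡∅ (false ∷ S) ∣S∣≡0 = cong (false ∷_) (∣S∣≡0⇒S≡∅ S ∣S∣≡0)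

∣b∷S∣ : ∀ {n} b (S : Subset n) → ∣ b ∷ S ∣ ≡ 𝟙 b + ∣ S ∣
∣b∷S∣ true S = refl
∣b∷S∣ false S = refl

∈⇒∣S∣≥1 : ∀ {n} (S : Subset n) i → S ∋ i → 1 ≤ ∣ S ∣
∈⇒∣S∣≥1 (true ∷ S) fz _ = s≤s z≤n
∈⇒∣S∣≥1 (b ∷ S) (fs i) i∈S =
  subst (1 ≤_) (sym (∣b∷S∣ b S)) (≤-trans (∈⇒∣S∣≥1 S i i∈S) (m≤n+m _ (𝟙 b)))

∣S∣≤1⇒ : ∀ {n} (S : Subset n) → ∣ S ∣ ≤ 1 → AtMostOnePoint S
∣S∣≤1⇒ (b ∷ S) _ fz fz _ _ = refl
∣S∣≤1⇒ (true ∷ S) ∣S∣≤1 fz (fs j) _ j∈S = ⊥-elim (1+n≰n (≤-trans (s≤s (∈⇒∣S∣≥1 S j j∈S)) ∣S∣≤1))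
∣S∣≤1⇒ (true ∷ S) ∣S∣≤1 (fs i) fz i∈S _ = ⊥-elim (1+n≰n (≤-trans (s≤s (∈⇒∣S∣≥1 S i i∈S)) ∣S∣≤1))
∣S∣≤1⇒ (b ∷ S) ∣S∣≤1 (fs i) (fs j) i∈S j∈S =
  cong fs (∣S∣≤1⇒ S (≤-trans (m≤n+m _ (𝟙 b)) (subst (_≤ 1) (∣b∷S∣ b S) ∣S∣≤1)) i j i∈S j∈S)

⇒∣S∣≤1 : ∀ {n} (S : Subset n) → AtMostOnePoint S → ∣ S ∣ ≤ 1
⇒∣S∣≤1 [] _ = z≤n
⇒∣S∣≤1 (false ∷ S) unique = ⇒∣S∣≤1 S (λ i j i∈S j∈S → Finₚ.suc-injective (unique (fs i) (fs j) i∈S j∈S))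
⇒∣S∣≤1 {suc n} (true ∷ S) unique =
  subst (λ S → ∣ true ∷ S ∣ ≤ 1) (sym (∅-unique S only-0)) (s≤s (≤-reflexive (∣⊥∣≡0 n)))
  where
  only-0 : ∀ i → lookup S i ≡ false
  only-0 i = ≢true⇒≡false (λ i∈S → case unique fz (fs i) refl i∈S of λ ())

lookup-⁅⁆ : ∀ {n} (x y : Fin n) → lookup ⁅ x ⁆ y ≡ does (x ≟ᶠ y)
lookup-⁅⁆ fz fz = refl
lookup-⁅⁆ fz (fs y) = lookup-∅ y
lookup-⁅⁆ (fs x) fz = refl
lookup-⁅⁆ (fs x) (fs y) = lookup-⁅⁆ x y

⁅⁆-unique : ∀ {n} (S : Subset n) x → S ∋ x → (∀ y → S ∋ y → y ≡ x) → S ≡ ⁅ x ⁆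
⁅⁆-unique S x x∈S only-x = lookup-ext S ⁅ x ⁆ same
  where
  same : ∀ i → lookup S i ≡ lookup ⁅ x ⁆ i
  same i rewrite lookup-⁅⁆ x i with x ≟ᶠ i
  ... | yes refl = x∈S
  ... | no x≢i = ≢true⇒≡false (λ i∈S → x≢i (sym (only-x i i∈S)))

lookup-∩ : ∀ {n} (S S′ : Subset n) x → lookup (S ∩ S′) x ≡ (lookup S x ∧ lookup S′ x)
lookup-∩ S S′ x = Vec.lookup-zipWith _∧_ x S S′

module _ {A : Set} where

  subFun : ∀ {n} → (Subset n → A) → SubFun A n
  subFun {zero} f = f []
  subFun {suc n} f = subFun (f ∘ (false ∷_)) , subFun (f ∘ (true ∷_))

  app-subFun : ∀ {n} (f : Subset n → A) S → app {n = n} (subFun f) S ≡ f S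
  app-subFun {zero} f [] = refl
  app-subFun {suc n} f (false ∷ S) = app-subFun (f ∘ (false ∷_)) S
  app-subFun {suc n} f (true ∷ S) = app-subFun (f ∘ (true ∷_)) S

  app-injective : ∀ {n} (a b : SubFun A n) → (∀ S → app {n = n} a S ≡ app b S) → a ≡ b
  app-injective {zero} a b same = same []
  app-injective {suc n} (a , a′) (b , b′) same =
    cong₂ _,_ (app-injective {n} a b (same ∘ (false ∷_))) (app-injective {n} a′ b′ (same ∘ (true ∷_)))

  ≡-dec-SubFun : DecidableEquality A → ∀ {n} → DecidableEquality (SubFun A n)
  ≡-dec-SubFun _≟_ {zero} = _≟_
  ≡-dec-SubFun _≟_ {suc n} = ≡-dec-SubFun _≟_ ×-≟ ≡-dec-SubFun _≟_

  allValues : (A → Bool) → ∀ {n} → SubFun A n → Bool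
  allValues P {zero} a = P a
  allValues P {suc n} (f , g) = allValues P f ∧ allValues P g

  allValues⇐ : ∀ (P : A → Bool) {n} (f : SubFun A n) → (∀ S → P (app {n = n} f S) ≡ true) → allValues P f ≡ true
  allValues⇐ P {zero} a P-holds = P-holds []
  allValues⇐ P {suc n} (f , g) P-holds =
    ∧-≡true⇐ (allValues⇐ P {n} f (P-holds ∘ (false ∷_))) (allValues⇐ P {n} g (P-holds ∘ (true ∷_)))

  allSubFuns-enumerates : ∀ {xs : List A} {_≟_ : DecidableEquality A} {inA : A → Bool} →
    Enumerates xs _≟_ inA → ∀ n → Enumerates (allSubFuns xs n) (≡-dec-SubFun _≟_) (allValues inA)
  allSubFuns-enumerates en zero = en
  allSubFuns-enumerates en (suc n) = product-enumerates (allSubFuns-enumerates en n) (allSubFuns-enumerates en n)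

mult : ∀ {n} → Multiset n → Subset n → ℕ
mult {n} = app {n = n}

_≟ₘ_ : ∀ {n} → DecidableEquality (Multiset n)
_≟ₘ_ = ≡-dec-SubFun ℕₚ._≟_

AtMostTwice : ∀ {n} → Multiset n → Bool
AtMostTwice = allValues (_≤ᵇ 2)

candidates-enumerate : ∀ n → Enumerates (candidates n) _≟ₘ_ AtMostTwice
candidates-enumerate = allSubFuns-enumerates (enumerates values)
  where
  values : ∀ a → ∑ (0 ∷ 1 ∷ 2 ∷ []) (λ x → 𝟙 (does (x ℕₚ.≟ a))) ≡ 𝟙 (a ≤ᵇ 2)
  values 0 = refl
  values 1 = refl
  values 2 = refl
  values (suc (suc (suc _))) = refl

count≡∑𝟙 : ∀ (P : (n : ℕ) → Multiset n → Bool) n → count P n ≡ ∑ (candidates n) (𝟙 ∘ P n)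
count≡∑𝟙 P n = length-filter≡∑𝟙 (candidates n) (P n)

Occurs : ∀ {n} → Multiset n → Subset n → Set
Occurs m S = 1 ≤ mult m S

incidence : ∀ {n} → Multiset n → Fin n → Subset n → ℕ
incidence m x S = if lookup S x then mult m S else 0

incidence-∋ : ∀ {n} (m : Multiset n) x S → S ∋ x → incidence m x S ≡ mult m S
incidence-∋ m x S S∋x rewrite S∋x = refl

incidence-pos : ∀ {n} (m : Multiset n) x S {k} → 1 ≤ k → k ≤ incidence m x S → S ∋ x × k ≤ mult m S
incidence-pos m x S 1≤k k≤inc with lookup S x
... | true = refl , k≤inc
... | false = ⊥-elim (1+n≰n (≤-trans 1≤k k≤inc))

TwoCover : ∀ {n} → Multiset n → Set
TwoCover m = mult m ∅ ≡ 0 × ∀ x → degree m x ≡ 2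

Proper : ∀ {n} → Multiset n → Set
Proper m = ∀ S → mult m S ≤ 1

Restricted : ∀ {n} → Multiset n → Set
Restricted m = (∀ S S′ → S ≢ S′ → Occurs m S → Occurs m S′ → AtMostOnePoint (S ∩ S′))
             × (∀ S → 2 ≤ mult m S → AtMostOnePoint S)

Twins : ∀ {n} → Multiset n → Fin n → Fin n → Set
Twins m x y = ∀ S → Occurs m S → lookup S x ≡ lookup S y

TwinFree : ∀ {n} → Multiset n → Set
TwinFree m = ∀ x y → x ≢ y → ¬ Twins m x y

module _ {n} (m : Multiset n) where

  private
    absentIfEmpty : Subset n → Bool
    absentIfEmpty S = if ∣ S ∣ ≡ᵇ 0 then app m S ≡ᵇ 0 else true

    degreeTwo : Fin n → Bool
    degreeTwo x = degree m x ≡ᵇ 2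

    atMostOnce : Subset n → Bool
    atMostOnce S = app m S ≤ᵇ 1

    meetOnce : Subset n → Subset n → Bool
    meetOnce S S′ = if (S ==ˢ S′) then true
                    else if (1 ≤ᵇ app m S) ∧ (1 ≤ᵇ app m S′) then ∣ S ∩ S′ ∣ ≤ᵇ 1 else true

    repeatedSmall : Subset n → Bool
    repeatedSmall S = if 2 ≤ᵇ app m S then ∣ S ∣ ≤ᵇ 1 else true

  isTwoCover⇒TwoCover : isTwoCover m ≡ true → TwoCover m
  isTwoCover⇒TwoCover isCover with ∧-≡true⇒ {allS absentIfEmpty} isCover
  ... | absent , degrees = ≡ᵇ-sound empty , λ x → ≡ᵇ-sound (all≡true⇒ ∈-allFin degreeTwo degrees x)
    where
    empty : (app m ∅ ≡ᵇ 0) ≡ true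
    empty = subst (λ k → (if k ≡ᵇ 0 then app m ∅ ≡ᵇ 0 else true) ≡ true) (∣⊥∣≡0 n)
                  (all≡true⇒ ∈-allSubsets absentIfEmpty absent ∅)

  TwoCover⇒isTwoCover : TwoCover m → isTwoCover m ≡ true
  TwoCover⇒isTwoCover (empty , degrees) =
    ∧-≡true⇐ (all≡true⇐ ∈-allSubsets absentIfEmpty absent) (all≡true⇐ ∈-allFin degreeTwo (≡ᵇ-complete ∘ degrees))
    where
    absent : ∀ S → absentIfEmpty S ≡ true
    absent S with ∣ S ∣ ≡ᵇ 0 in ∣S∣≡ᵇ0
    ... | false = refl
    ... | true rewrite ∣S∣≡0⇒S≡∅ S (≡ᵇ-sound ∣S∣≡ᵇ0) = ≡ᵇ-complete empty

  isProper⇒Proper : isProper m ≡ true → Proper m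
  isProper⇒Proper isP S = ≤ᵇ-sound (all≡true⇒ ∈-allSubsets atMostOnce isP S)

  Proper⇒isProper : Proper m → isProper m ≡ true
  Proper⇒isProper proper = all≡true⇐ ∈-allSubsets atMostOnce (≤ᵇ-complete ∘ proper)

  isRestricted⇒Restricted : isRestricted m ≡ true → Restricted m
  isRestricted⇒Restricted isR with ∧-≡true⇒ {allS (λ S → allS (meetOnce S))} isR
  ... | meet , repeats = pairs , singles
    where
    pairs : ∀ S S′ → S ≢ S′ → Occurs m S → Occurs m S′ → AtMostOnePoint (S ∩ S′)
    pairs S S′ S≢S′ occ occ′ with all≡true⇒ ∈-allSubsets (meetOnce S) (all≡true⇒ ∈-allSubsets _ meet S) S′
    ... | check rewrite ==ˢ≡does≟ˢ S S′ with S ≟ˢ S′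
    ...   | yes S≡S′ = ⊥-elim (S≢S′ S≡S′)
    ...   | no _ rewrite ≤ᵇ-complete occ | ≤ᵇ-complete occ′ = ∣S∣≤1⇒ (S ∩ S′) (≤ᵇ-sound check)
    singles : ∀ S → 2 ≤ mult m S → AtMostOnePoint S
    singles S 2≤mS with all≡true⇒ ∈-allSubsets repeatedSmall repeats S
    ... | check rewrite ≤ᵇ-complete 2≤mS = ∣S∣≤1⇒ S (≤ᵇ-sound check)

  Restricted⇒isRestricted : Restricted m → isRestricted m ≡ true
  Restricted⇒isRestricted (pairs , singles) =
    ∧-≡true⇐ (all≡true⇐ ∈-allSubsets _ (λ S → all≡true⇐ ∈-allSubsets (meetOnce S) (pair-check S)))
             (all≡true⇐ ∈-allSubsets repeatedSmall single-check)
    where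
    pair-check : ∀ S S′ → meetOnce S S′ ≡ true
    pair-check S S′ rewrite ==ˢ≡does≟ˢ S S′ with S ≟ˢ S′
    ... | yes _ = refl
    ... | no S≢S′ with 1 ≤ᵇ app m S in occ | 1 ≤ᵇ app m S′ in occ′
    ...   | true | true = ≤ᵇ-complete (⇒∣S∣≤1 (S ∩ S′) (pairs S S′ S≢S′ (≤ᵇ-sound occ) (≤ᵇ-sound occ′)))
    ...   | true | false = refl
    ...   | false | _ = refl
    single-check : ∀ S → repeatedSmall S ≡ true
    single-check S with 2 ≤ᵇ app m S in repeated
    ... | true = ≤ᵇ-complete (⇒∣S∣≤1 S (singles S (≤ᵇ-sound repeated)))
    ... | false = refl

mult≤degree : ∀ {n} (m : Multiset n) x S → S ∋ x → mult m S ≤ degree m x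
mult≤degree {n} m x S S∋x =
  subst (_≤ degree m x) (incidence-∋ m x S S∋x) (term≤∑ (allSubsets-enumerates n) (incidence m x) S)

TwoCover⇒mult≤2 : ∀ {n} (m : Multiset n) → TwoCover m → ∀ S → mult m S ≤ 2
TwoCover⇒mult≤2 m (empty , degrees) S with ∅-or-nonempty S
... | inj₁ refl = subst (_≤ 2) (sym empty) z≤n
... | inj₂ (x , S∋x) = subst (mult m S ≤_) (degrees x) (mult≤degree m x S S∋x)

TwoCover⇒AtMostTwice : ∀ {n} (m : Multiset n) → TwoCover m → AtMostTwice m ≡ true
TwoCover⇒AtMostTwice m cover = allValues⇐ (_≤ᵇ 2) m (≤ᵇ-complete ∘ TwoCover⇒mult≤2 m cover)

isTwoCover⇒AtMostTwice : ∀ {N} (C : Multiset N) → isTwoCover C ≡ true → AtMostTwice C ≡ true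
isTwoCover⇒AtMostTwice C = TwoCover⇒AtMostTwice C ∘ isTwoCover⇒TwoCover C

-- Restricted 2-covers are the twin-free ones

twins? : ∀ {n} (m : Multiset n) x y → Dec (Twins m x y)
twins? m x y = ∀-subset? (λ S → (1 ≤? mult m S) →-dec (lookup S x ≟ᵇ lookup S y))

module _ {n} {m : Multiset n} where

  twins-sym : ∀ {x y} → Twins m x y → Twins m y x
  twins-sym x~y S occ = sym (x~y S occ)

  twins-trans : ∀ {x y z} → Twins m x y → Twins m y z → Twins m x z
  twins-trans x~y y~z S occ = trans (x~y S occ) (y~z S occ)

module _ {n} {m : Multiset n} (cover : TwoCover m) where

  private
    enum : Enumerates (allSubsets n) _≟ˢ_ (λ _ → true)
    enum = allSubsets-enumerates n
    three≰2 : ¬ 3 ≤ 2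
    three≰2 (s≤s (s≤s ()))

  sole-member : ∀ {S x} → 2 ≤ mult m S → S ∋ x → ∀ T → T ≢ S → Occurs m T → lookup T x ≡ false
  sole-member {S} {x} 2≤mS S∋x T T≢S occ = ≢true⇒≡false λ T∋x → three≰2 (begin
    3
      ≤⟨ +-mono-≤ 2≤mS occ ⟩
    mult m S + mult m T
      ≡⟨ sym (cong₂ _+_ (incidence-∋ m x S S∋x) (incidence-∋ m x T T∋x)) ⟩
    incidence m x S + incidence m x T
      ≤⟨ two-terms≤∑ enum (incidence m x) S T (T≢S ∘ sym) ⟩
    degree m x
      ≡⟨ proj₂ cover x ⟩
    2 ∎)
    where open ≤-Reasoning

  sole-members : ∀ {S S′ x} → S ≢ S′ → Occurs m S → Occurs m S′ → S ∋ x → S′ ∋ x →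
                 ∀ T → T ≢ S → T ≢ S′ → Occurs m T → lookup T x ≡ false
  sole-members {S} {S′} {x} S≢S′ occ occ′ S∋x S′∋x T T≢S T≢S′ occT = ≢true⇒≡false λ T∋x → three≰2 (begin
    3
      ≤⟨ +-mono-≤ occ (+-mono-≤ occ′ occT) ⟩
    mult m S + (mult m S′ + mult m T)
      ≡⟨ sym (cong₂ _+_ (incidence-∋ m x S S∋x) (cong₂ _+_ (incidence-∋ m x S′ S′∋x) (incidence-∋ m x T T∋x))) ⟩
    incidence m x S + (incidence m x S′ + incidence m x T)
      ≤⟨ three-terms≤∑ enum (incidence m x) S S′ T S≢S′ (T≢S ∘ sym) (T≢S′ ∘ sym) ⟩
    degree m x
      ≡⟨ proj₂ cover x ⟩
    2 ∎)
    where open ≤-Reasoning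

  Restricted⇒TwinFree : Restricted m → TwinFree m
  Restricted⇒TwinFree (pairs , singles) x y x≢y twins with ∑≡2⇒ enum (incidence m x) (proj₂ cover x)
  ... | inj₁ (S , 2≤inc) with incidence-pos m x S (s≤s z≤n) 2≤inc
  ...   | S∋x , 2≤mS = x≢y (singles S 2≤mS x y S∋x (trans (sym (twins S (≤-trans (s≤s z≤n) 2≤mS))) S∋x))
  Restricted⇒TwinFree (pairs , singles) x y x≢y twins
      | inj₂ (S , S′ , S≢S′ , 1≤inc , 1≤inc′)
      with incidence-pos m x S ≤-refl 1≤inc | incidence-pos m x S′ ≤-refl 1≤inc′
  ...   | S∋x , occ | S′∋x , occ′ = x≢y (pairs S S′ S≢S′ occ occ′ x y (both S∋x S′∋x) (both S∋y S′∋y))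
    where
    S∋y : S ∋ y
    S∋y = trans (sym (twins S occ)) S∋x
    S′∋y : S′ ∋ y
    S′∋y = trans (sym (twins S′ occ′)) S′∋x
    both : ∀ {z} → S ∋ z → S′ ∋ z → (S ∩ S′) ∋ z
    both {z} S∋z S′∋z = trans (lookup-∩ S S′ z) (cong₂ _∧_ S∋z S′∋z)

  TwinFree⇒Restricted : TwinFree m → Restricted m
  TwinFree⇒Restricted twin-free = pairs , singles
    where
    distinct-or-twins : ∀ x y → (x ≢ y → Twins m x y) → x ≡ y
    distinct-or-twins x y twins with x ≟ᶠ y
    ... | yes x≡y = x≡y
    ... | no x≢y = ⊥-elim (twin-free x y x≢y (twins x≢y))

    singles : ∀ S → 2 ≤ mult m S → AtMostOnePoint S
    singles S 2≤mS x y S∋x S∋y = distinct-or-twins x y λ _ T occT → same T occT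
      where
      same : ∀ T → Occurs m T → lookup T x ≡ lookup T y
      same T occT with T ≟ˢ S
      ... | yes refl = trans S∋x (sym S∋y)
      ... | no T≢S = trans (sole-member 2≤mS S∋x T T≢S occT) (sym (sole-member 2≤mS S∋y T T≢S occT))

    pairs : ∀ S S′ → S ≢ S′ → Occurs m S → Occurs m S′ → AtMostOnePoint (S ∩ S′)
    pairs S S′ S≢S′ occ occ′ x y S∩S′∋x S∩S′∋y = distinct-or-twins x y λ _ T occT → same T occT
      where
      split : ∀ {z} → (S ∩ S′) ∋ z → S ∋ z × S′ ∋ z
      split {z} S∩S′∋z = ∧-≡true⇒ (trans (sym (lookup-∩ S S′ z)) S∩S′∋z)
      same : ∀ T → Occurs m T → lookup T x ≡ lookup T y
      same T occT with T ≟ˢ S | T ≟ˢ S′ | split S∩S′∋x | split S∩S′∋y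
      ... | yes refl | _ | S∋x , _ | S∋y , _ = trans S∋x (sym S∋y)
      ... | no _ | yes refl | _ , S′∋x | _ , S′∋y = trans S′∋x (sym S′∋y)
      ... | no T≢S | no T≢S′ | S∋x , S′∋x | S∋y , S′∋y =
        trans (sole-members S≢S′ occ occ′ S∋x S′∋x T T≢S T≢S′ occT)
              (sym (sole-members S≢S′ occ occ′ S∋y S′∋y T T≢S T≢S′ occT))

-- Twin classes: s and t from u and v

module TwinInsertion {N : ℕ} (p : Fin (suc N)) where

  ins : Bool → Subset N → Subset (suc N)
  ins b T = insertAt T p b

  rem : Subset (suc N) → Subset N
  rem S = removeAt S p

  rem-ins : ∀ b T → rem (ins b T) ≡ T
  rem-ins b T = Vec.removeAt-insertAt T p b

  ins-rem : ∀ S → ins (lookup S p) (rem S) ≡ S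
  ins-rem S = Vec.insertAt-removeAt S p

  lookup-ins-pivot : ∀ b T → lookup (ins b T) p ≡ b
  lookup-ins-pivot b T = Vec.insertAt-lookup T p b

  lookup-ins-punchIn : ∀ b T x → lookup (ins b T) (punchIn p x) ≡ lookup T x
  lookup-ins-punchIn b T x = Vec.insertAt-punchIn T p b x

  rem-∅ : rem ∅ ≡ ∅
  rem-∅ = ∅-unique _ (λ i → trans (lookup-removeAt ∅ p i) (lookup-∅ (punchIn p i)))

  addTwin : Fin N → Multiset N → Multiset (suc N)
  addTwin c C = subFun (λ S → if does (lookup S p ≟ᵇ lookup (rem S) c) then mult C (rem S) else 0)

  -- Inverse to addTwin c only on multisets in which the pivot and punchIn p c are twins.
  removeTwin : Fin N → Multiset (suc N) → Multiset N
  removeTwin c D = subFun (λ T → mult D (ins (lookup T c) T))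

  mult-addTwin : ∀ c C S → mult (addTwin c C) S ≡ (if does (lookup S p ≟ᵇ lookup (rem S) c) then mult C (rem S) else 0)
  mult-addTwin c C = app-subFun _

  mult-addTwin-ins : ∀ c C b T → mult (addTwin c C) (ins b T) ≡ (if does (b ≟ᵇ lookup T c) then mult C T else 0)
  mult-addTwin-ins c C b T rewrite mult-addTwin c C (ins b T) | rem-ins b T | lookup-ins-pivot b T = refl

  mult-addTwin-copy : ∀ c C T → mult (addTwin c C) (ins (lookup T c) T) ≡ mult C T
  mult-addTwin-copy c C T rewrite mult-addTwin-ins c C (lookup T c) T with lookup T c ≟ᵇ lookup T c
  ... | yes _ = refl
  ... | no ≢ = ⊥-elim (≢ refl)

  mult-removeTwin : ∀ c D T → mult (removeTwin c D) T ≡ mult D (ins (lookup T c) T)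
  mult-removeTwin c D = app-subFun _

  removeTwin-addTwin : ∀ c C → removeTwin c (addTwin c C) ≡ C
  removeTwin-addTwin c C = app-injective _ _ λ T → trans (mult-removeTwin c (addTwin c C) T) (mult-addTwin-copy c C T)

  addTwin-removeTwin : ∀ c D → Twins D p (punchIn p c) → addTwin c (removeTwin c D) ≡ D
  addTwin-removeTwin c D p~c = app-injective _ _ same
    where
    same : ∀ S → mult (addTwin c (removeTwin c D)) S ≡ mult D S
    same S rewrite mult-addTwin c (removeTwin c D) S | lookup-removeAt S p c
      with lookup S p ≟ᵇ lookup S (punchIn p c)
    ... | yes Sp≡Sc rewrite mult-removeTwin c D (rem S) | lookup-removeAt S p c | sym Sp≡Sc =
          cong (mult D) (ins-rem S)
    ... | no Sp≢Sc with mult D S in mDS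
    ...   | zero = refl
    ...   | suc _ = ⊥-elim (Sp≢Sc (p~c S (subst (1 ≤_) (sym mDS) (s≤s z≤n))))

  degree-addTwin-punchIn : ∀ c C x → degree (addTwin c C) (punchIn p x) ≡ degree C x
  degree-addTwin-punchIn c C x = trans (∑-allSubsets-insertAt N p _) (∑-cong (allSubsets N) split)
    where
    split : ∀ T → incidence (addTwin c C) (punchIn p x) (ins false T) + incidence (addTwin c C) (punchIn p x) (ins true T)
                ≡ incidence C x T
    split T rewrite lookup-ins-punchIn false T x | lookup-ins-punchIn true T x
                  | mult-addTwin-ins c C false T | mult-addTwin-ins c C true T
      with lookup T x | lookup T c
    ... | true | true = refl
    ... | true | false = +-identityʳ _
    ... | false | _ = refl

  degree-addTwin-pivot : ∀ c C → degree (addTwin c C) p ≡ degree C c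
  degree-addTwin-pivot c C = trans (∑-allSubsets-insertAt N p _) (∑-cong (allSubsets N) split)
    where
    split : ∀ T → incidence (addTwin c C) p (ins false T) + incidence (addTwin c C) p (ins true T) ≡ incidence C c T
    split T rewrite lookup-ins-pivot false T | lookup-ins-pivot true T | mult-addTwin-ins c C true T with lookup T c
    ... | true = refl
    ... | false = refl

  mult-addTwin-∅ : ∀ c C → mult (addTwin c C) ∅ ≡ mult C ∅
  mult-addTwin-∅ c C rewrite mult-addTwin c C ∅ | rem-∅ | lookup-∅ c | lookup-∅ p = refl

  addTwin-TwoCover : ∀ c C → TwoCover C → TwoCover (addTwin c C)
  addTwin-TwoCover c C (empty , degrees) = trans (mult-addTwin-∅ c C) empty , degree-two
    where
    degree-two : ∀ y → degree (addTwin c C) y ≡ 2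
    degree-two y with punchIn-or-pivot p y
    ... | inj₁ refl = trans (degree-addTwin-pivot c C) (degrees c)
    ... | inj₂ (x , refl) = trans (degree-addTwin-punchIn c C x) (degrees x)

  addTwin-TwoCover⁻ : ∀ c C → TwoCover (addTwin c C) → TwoCover C
  addTwin-TwoCover⁻ c C (empty , degrees) =
    trans (sym (mult-addTwin-∅ c C)) empty , λ x → trans (sym (degree-addTwin-punchIn c C x)) (degrees (punchIn p x))

  addTwin-Proper : ∀ c C → Proper C → Proper (addTwin c C)
  addTwin-Proper c C proper S rewrite mult-addTwin c C S with does (lookup S p ≟ᵇ lookup (rem S) c)
  ... | true = proper (rem S)
  ... | false = z≤n

  addTwin-Proper⁻ : ∀ c C → Proper (addTwin c C) → Proper C
  addTwin-Proper⁻ c C proper T = subst (_≤ 1) (mult-addTwin-copy c C T) (proper (ins (lookup T c) T))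

  occurs-addTwin : ∀ c C S → Occurs (addTwin c C) S → lookup S p ≡ lookup S (punchIn p c) × Occurs C (rem S)
  occurs-addTwin c C S occ rewrite mult-addTwin c C S with lookup S p ≟ᵇ lookup (rem S) c
  ... | yes Sp≡Sc = trans Sp≡Sc (lookup-removeAt S p c) , occ
  ... | no _ = ⊥-elim (1+n≰n occ)

  occurs-addTwin-copy : ∀ c C T → Occurs C T → Occurs (addTwin c C) (ins (lookup T c) T)
  occurs-addTwin-copy c C T occ = subst (1 ≤_) (sym (mult-addTwin-copy c C T)) occ

  twins-addTwin-punchIn : ∀ c C x y → Twins C x y → Twins (addTwin c C) (punchIn p x) (punchIn p y)
  twins-addTwin-punchIn c C x y x~y S occ =
    trans (sym (lookup-removeAt S p x)) (trans (x~y (rem S) (proj₂ (occurs-addTwin c C S occ))) (lookup-removeAt S p y))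

  twins-addTwin-punchIn⁻ : ∀ c C x y → Twins (addTwin c C) (punchIn p x) (punchIn p y) → Twins C x y
  twins-addTwin-punchIn⁻ c C x y x~y T occ =
    trans (sym (lookup-ins-punchIn (lookup T c) T x))
      (trans (x~y (ins (lookup T c) T) (occurs-addTwin-copy c C T occ)) (lookup-ins-punchIn (lookup T c) T y))

  twins-addTwin-pivot : ∀ c C → Twins (addTwin c C) p (punchIn p c)
  twins-addTwin-pivot c C S occ = proj₁ (occurs-addTwin c C S occ)

  twins-addTwin-pivot⁻ : ∀ c C y → Twins (addTwin c C) p (punchIn p y) → Twins C c y
  twins-addTwin-pivot⁻ c C y p~y T occ =
    trans (sym (lookup-ins-pivot (lookup T c) T))
      (trans (p~y (ins (lookup T c) T) (occurs-addTwin-copy c C T occ)) (lookup-ins-punchIn (lookup T c) T y))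

isTwoCover-addTwin : ∀ {N} (p : Fin (suc N)) c C → isTwoCover (TwinInsertion.addTwin p c C) ≡ isTwoCover C
isTwoCover-addTwin p c C = bool-ext
  (TwoCover⇒isTwoCover C ∘ addTwin-TwoCover⁻ c C ∘ isTwoCover⇒TwoCover _)
  (TwoCover⇒isTwoCover _ ∘ addTwin-TwoCover c C ∘ isTwoCover⇒TwoCover C)
  where open TwinInsertion p

isProper-addTwin : ∀ {N} (p : Fin (suc N)) c C → isProper (TwinInsertion.addTwin p c C) ≡ isProper C
isProper-addTwin p c C = bool-ext
  (Proper⇒isProper C ∘ addTwin-Proper⁻ c C ∘ isProper⇒Proper _)
  (Proper⇒isProper _ ∘ addTwin-Proper c C ∘ isProper⇒Proper C)
  where open TwinInsertion p

Isolated : ∀ {N} → Multiset N → Fin N → Set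
Isolated C x = ∀ y → x ≢ y → ¬ Twins C x y

IsolatedBelow : ∀ {N} → ℕ → Multiset N → Set
IsolatedBelow j C = ∀ x → toℕ x < j → Isolated C x

ClassMin : ∀ {N} → Multiset N → Fin N → Set
ClassMin C x = ∀ y → toℕ y < toℕ x → ¬ Twins C y x

isolatedBelow? : ∀ {N} j (C : Multiset N) → Dec (IsolatedBelow j C)
isolatedBelow? j C = Finₚ.all? λ x → (toℕ x <? j) →-dec Finₚ.all? λ y → ¬? (x ≟ᶠ y) →-dec ¬? (twins? C x y)

classMin? : ∀ {N} (C : Multiset N) x → Dec (ClassMin C x)
classMin? C x = Finₚ.all? λ y → (toℕ y <? toℕ x) →-dec ¬? (twins? C y x)

classMinFrom? : ∀ {N} j (C : Multiset N) x → Dec (j ≤ toℕ x × ClassMin C x)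
classMinFrom? j C x = (j ≤? toℕ x) ×-dec classMin? C x

classesFrom : ∀ {N} → ℕ → Multiset N → ℕ
classesFrom {N} j C = ∑ (allFin N) (𝟙 ∘ does ∘ classMinFrom? j C)

TwinFree⇔IsolatedBelow : ∀ {N} (C : Multiset N) → TwinFree C ⇔ IsolatedBelow N C
TwinFree⇔IsolatedBelow C = mk⇔ (λ twin-free x _ → twin-free x) (λ isolated x → isolated x (toℕ<n x))

restricted⇔twin-free : ∀ {k} (C : Multiset k) → (isTwoCover C ∧ does (isolatedBelow? k C)) ≡ (isTwoCover C ∧ isRestricted C)
restricted⇔twin-free {k} C = bool-ext to from
  where
  to : (isTwoCover C ∧ does (isolatedBelow? k C)) ≡ true → (isTwoCover C ∧ isRestricted C) ≡ true
  to cC with ∧-≡true⇒ {isTwoCover C} cC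
  ... | cover , isolated = ∧-≡true⇐ cover (Restricted⇒isRestricted C (TwinFree⇒Restricted (isTwoCover⇒TwoCover C cover)
          (Equivalence.from (TwinFree⇔IsolatedBelow C) (does⇒ (isolatedBelow? k C) isolated))))
  from : (isTwoCover C ∧ isRestricted C) ≡ true → (isTwoCover C ∧ does (isolatedBelow? k C)) ≡ true
  from cC with ∧-≡true⇒ {isTwoCover C} cC
  ... | cover , restricted = ∧-≡true⇐ cover (dec-true (isolatedBelow? k C) (Equivalence.to (TwinFree⇔IsolatedBelow C)
          (Restricted⇒TwinFree (isTwoCover⇒TwoCover C cover) (isRestricted⇒Restricted C restricted))))

module TwinClassStep {N : ℕ} (p : Fin (suc N)) where

  open TwinInsertion p

  private
    j : ℕ
    j = toℕ p

    below≢above : ∀ {M} (x c : Fin M) → toℕ x < j → j ≤ toℕ c → x ≢ c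
    below≢above x c x<j j≤c refl = 1+n≰n (≤-trans x<j j≤c)

  twinOfPivot? : (D : Multiset (suc N)) (x : Fin N) → Dec (Twins D p (punchIn p x))
  twinOfPivot? D x = twins? D p (punchIn p x)

  isolatedBelow-addTwin⁻ : ∀ c C → IsolatedBelow j (addTwin c C) → IsolatedBelow j C
  isolatedBelow-addTwin⁻ c C isolated x x<j y x≢y x~y =
    isolated (punchIn p x) (subst (_< j) (sym (toℕ-punchIn-< p x x<j)) x<j) (punchIn p y)
      (x≢y ∘ punchIn-injective p x y) (twins-addTwin-punchIn c C x y x~y)

  isolatedBelow-addTwin : ∀ c C → j ≤ toℕ c → IsolatedBelow j C → IsolatedBelow j (addTwin c C)
  isolatedBelow-addTwin c C j≤c isolated x′ x′<j y′ x′≢y′ x′~y′ with punchIn-or-pivot p x′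
  ... | inj₁ refl = 1+n≰n x′<j
  ... | inj₂ (x , refl) with punchIn<pivot⇒ p x x′<j | punchIn-or-pivot p y′
  ...   | x<j | inj₁ refl =
          isolated x x<j c (below≢above x c x<j j≤c) (twins-sym (twins-addTwin-pivot⁻ c C x (twins-sym x′~y′)))
  ...   | x<j | inj₂ (y , refl) =
          isolated x x<j y (x′≢y′ ∘ cong (punchIn p)) (twins-addTwin-punchIn⁻ c C x y x′~y′)

  classMin-addTwin-pivot : ∀ c C → j ≤ toℕ c → IsolatedBelow j C → ClassMin (addTwin c C) p
  classMin-addTwin-pivot c C j≤c isolated y′ y′<j y′~p with punchIn-or-pivot p y′
  ... | inj₁ refl = 1+n≰n y′<j
  ... | inj₂ (y , refl) with punchIn<pivot⇒ p y y′<j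
  ...   | y<j = isolated y y<j c (below≢above y c y<j j≤c) (twins-sym (twins-addTwin-pivot⁻ c C y (twins-sym y′~p)))

  classMin-addTwin-punchIn : ∀ c C → ClassMin C c → ∀ x → x ≢ c → j ≤ toℕ x →
                             ClassMin (addTwin c C) (punchIn p x) ⇔ ClassMin C x
  classMin-addTwin-punchIn c C c-min x x≢c j≤x = mk⇔ to from
    where
    to : ClassMin (addTwin c C) (punchIn p x) → ClassMin C x
    to x′-min y y<x y~x = x′-min (punchIn p y) (punchIn-mono-< p y x y<x) (twins-addTwin-punchIn c C y x y~x)
    from : ClassMin C x → ClassMin (addTwin c C) (punchIn p x)
    from x-min y′ y′<x′ y′~x′ with punchIn-or-pivot p y′
    ... | inj₂ (y , refl) = x-min y (punchIn-cancel-< p y x y′<x′) (twins-addTwin-punchIn⁻ c C y x y′~x′)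
    ... | inj₁ refl with twins-addTwin-pivot⁻ c C x y′~x′ | <-cmp (toℕ c) (toℕ x)
    ...   | c~x | tri< c<x _ _ = x-min c c<x c~x
    ...   | c~x | tri≈ _ c≡x _ = x≢c (sym (toℕ-injective c≡x))
    ...   | c~x | tri> _ _ x<c = c-min x x<c (twins-sym c~x)

  private
    classMinFrom-pivot : ∀ c C → j ≤ toℕ c → IsolatedBelow j C → does (classMinFrom? j (addTwin c C) p) ≡ true
    classMinFrom-pivot c C j≤c isolated = dec-true (classMinFrom? j _ p) (≤-refl , classMin-addTwin-pivot c C j≤c isolated)

    classMinFrom-punchIn : ∀ c C → j ≤ toℕ c → ClassMin C c → ∀ x →
      𝟙 (does (classMinFrom? j (addTwin c C) (punchIn p x))) ≡ (if does (x ≟ᶠ c) then 0 else 𝟙 (does (classMinFrom? j C x)))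
    classMinFrom-punchIn c C j≤c c-min x with x ≟ᶠ c
    ... | yes refl = cong 𝟙 $ dec-false (classMinFrom? j _ (punchIn p c))
                       λ (_ , c′-min) → c′-min p (subst (j <_) (sym (toℕ-punchIn-≥ p c j≤c)) (s≤s j≤c))
                                                 (twins-addTwin-pivot c C)
    ... | no x≢c = cong 𝟙 $ does-⇔ (mk⇔ to from) (classMinFrom? j _ (punchIn p x)) (classMinFrom? j C x)
      where
      to : j ≤ toℕ (punchIn p x) × ClassMin (addTwin c C) (punchIn p x) → j ≤ toℕ x × ClassMin C x
      to (j≤x′ , x′-min) with Equivalence.to (pivot≤punchIn⇔ p x) j≤x′
      ... | j≤x = j≤x , Equivalence.to (classMin-addTwin-punchIn c C c-min x x≢c j≤x) x′-min
      from : j ≤ toℕ x × ClassMin C x → j ≤ toℕ (punchIn p x) × ClassMin (addTwin c C) (punchIn p x)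
      from (j≤x , x-min) = Equivalence.from (pivot≤punchIn⇔ p x) j≤x
                         , Equivalence.from (classMin-addTwin-punchIn c C c-min x x≢c j≤x) x-min

  classesFrom-addTwin : ∀ c C → j ≤ toℕ c → IsolatedBelow j C → ClassMin C c →
                        classesFrom j (addTwin c C) ≡ classesFrom j C
  classesFrom-addTwin c C j≤c isolated c-min = begin
    classesFrom j (addTwin c C)
      ≡⟨ ∑-allFin-punchIn N p (𝟙 ∘ does ∘ classMinFrom? j (addTwin c C)) ⟩
    𝟙 (does (classMinFrom? j (addTwin c C) p)) + ∑ (allFin N) (𝟙 ∘ does ∘ classMinFrom? j (addTwin c C) ∘ punchIn p)
      ≡⟨ cong₂ _+_ (cong 𝟙 (classMinFrom-pivot c C j≤c isolated)) (∑-cong (allFin N) (classMinFrom-punchIn c C j≤c c-min)) ⟩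
    1 + ∑ (allFin N) others
      ≡⟨ cong (λ b → 𝟙 b + ∑ (allFin N) others) (sym (dec-true (classMinFrom? j C c) (j≤c , c-min))) ⟩
    𝟙 (does (classMinFrom? j C c)) + ∑ (allFin N) others
      ≡⟨ sym (∑-extract (allFin-enumerates N) _ c) ⟩
    classesFrom j C ∎
    where
    open ≡-Reasoning
    others : Fin N → ℕ
    others x = if does (x ≟ᶠ c) then 0 else 𝟙 (does (classMinFrom? j C x))

  module _ (D : Multiset (suc N)) (isolated : IsolatedBelow j D) {c} (c-least : least (twinOfPivot? D) ≡ just c) where

    private
      p~c : Twins D p (punchIn p c)
      p~c = proj₁ (least-just (twinOfPivot? D) c-least)

    addTwin-removeTwin-least : addTwin c (removeTwin c D) ≡ D
    addTwin-removeTwin-least = addTwin-removeTwin c D p~c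

    least-twin-above : j ≤ toℕ c
    least-twin-above with toℕ c <? j
    ... | no c≮j = ≮⇒≥ c≮j
    ... | yes c<j = ⊥-elim (isolated (punchIn p c) (subst (_< j) (sym (toℕ-punchIn-< p c c<j)) c<j) p
                                     (punchInᵢ≢i p c) (twins-sym p~c))

    classMin-removeTwin : ClassMin (removeTwin c D) c
    classMin-removeTwin y y<c y~c = proj₂ (least-just (twinOfPivot? D) c-least) y y<c (twins-trans p~c (twins-sym y′~c′))
      where
      y′~c′ : Twins D (punchIn p y) (punchIn p c)
      y′~c′ = subst (λ D′ → Twins D′ (punchIn p y) (punchIn p c)) addTwin-removeTwin-least
                    (twins-addTwin-punchIn c (removeTwin c D) y c y~c)

    isolatedBelow-removeTwin : IsolatedBelow j (removeTwin c D)
    isolatedBelow-removeTwin =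
      isolatedBelow-addTwin⁻ c (removeTwin c D) (subst (IsolatedBelow j) (sym addTwin-removeTwin-least) isolated)

  least-twin-addTwin : ∀ c C → j ≤ toℕ c → IsolatedBelow j C → ClassMin C c → least (twinOfPivot? (addTwin c C)) ≡ just c
  least-twin-addTwin c C j≤c isolated c-min =
    least-char (twinOfPivot? (addTwin c C)) (twins-addTwin-pivot c C) λ y y<c p~y → not-twin y y<c (twins-addTwin-pivot⁻ c C y p~y)
    where
    not-twin : ∀ y → toℕ y < toℕ c → ¬ Twins C c y
    not-twin y y<c c~y with toℕ y <? j
    ... | yes y<j = isolated y y<j c (below≢above y c y<j j≤c) (twins-sym c~y)
    ... | no _ = c-min y y<c (twins-sym c~y)

  isolatedBelow-suc : ∀ D → IsolatedBelow j D → least (twinOfPivot? D) ≡ nothing → IsolatedBelow (suc j) D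
  isolatedBelow-suc D isolated no-twin x x<1+j y x≢y x~y with toℕ x <? j
  ... | yes x<j = isolated x x<j y x≢y x~y
  ... | no x≮j with toℕ-injective {i = x} {j = p} (≤-antisym (≤-pred x<1+j) (≮⇒≥ x≮j)) | punchIn-or-pivot p y
  ...   | refl | inj₁ refl = x≢y refl
  ...   | refl | inj₂ (y₀ , refl) = least-nothing (twinOfPivot? D) no-twin y₀ x~y

  isolatedBelow-suc⁻ : ∀ D → IsolatedBelow (suc j) D → least (twinOfPivot? D) ≡ nothing
  isolatedBelow-suc⁻ D isolated with least (twinOfPivot? D) in found
  ... | nothing = refl
  ... | just x = ⊥-elim (isolated p ≤-refl (punchIn p x) (punchInᵢ≢i p x ∘ sym) (proj₁ (least-just (twinOfPivot? D) found)))

  classesFrom-isolated-pivot : ∀ D → IsolatedBelow (suc j) D → classesFrom j D ≡ suc (classesFrom (suc j) D)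
  classesFrom-isolated-pivot D isolated = begin
    classesFrom j D
      ≡⟨ ∑-allFin-punchIn N p (𝟙 ∘ does ∘ classMinFrom? j D) ⟩
    𝟙 (does (classMinFrom? j D p)) + ∑ (allFin N) (𝟙 ∘ does ∘ classMinFrom? j D ∘ punchIn p)
      ≡⟨ cong₂ _+_ (cong 𝟙 at-pivot) (∑-cong (allFin N) (cong 𝟙 ∘ at-punchIn)) ⟩
    suc (∑ (allFin N) (𝟙 ∘ does ∘ classMinFrom? (suc j) D ∘ punchIn p))
      ≡⟨ cong (λ b → suc (𝟙 b + ∑ (allFin N) (𝟙 ∘ does ∘ classMinFrom? (suc j) D ∘ punchIn p)))
              (sym (dec-false (classMinFrom? (suc j) D p) (1+n≰n ∘ proj₁))) ⟩
    suc (𝟙 (does (classMinFrom? (suc j) D p)) + ∑ (allFin N) (𝟙 ∘ does ∘ classMinFrom? (suc j) D ∘ punchIn p))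
      ≡⟨ cong suc (sym (∑-allFin-punchIn N p (𝟙 ∘ does ∘ classMinFrom? (suc j) D))) ⟩
    suc (classesFrom (suc j) D) ∎
    where
    open ≡-Reasoning
    at-pivot : does (classMinFrom? j D p) ≡ true
    at-pivot = dec-true (classMinFrom? j D p) (≤-refl , λ y y<p y~p → isolated y (m≤n⇒m≤1+n y<p) p
                                                        (λ { refl → 1+n≰n y<p }) y~p)
    at-punchIn : ∀ x → does (classMinFrom? j D (punchIn p x)) ≡ does (classMinFrom? (suc j) D (punchIn p x))
    at-punchIn x = does-⇔
      (mk⇔ (λ (j≤x′ , x′-min) → ≤∧≢⇒< j≤x′ (punchInᵢ≢i p x ∘ sym ∘ toℕ-injective) , x′-min)
           (λ (j<x′ , x′-min) → <⇒≤ j<x′ , x′-min))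
      (classMinFrom? j D (punchIn p x)) (classMinFrom? (suc j) D (punchIn p x))

markedCandidates : ∀ N → List (Multiset N × Fin N)
markedCandidates N = concatMap (λ C → map (C ,_) (allFin N)) (candidates N)

stirling₂ : ℕ → ℕ → ℕ
stirling₂ zero zero = 1
stirling₂ zero (suc k) = 0
stirling₂ (suc n) zero = 0
stirling₂ (suc n) (suc k) = suc k * stirling₂ n (suc k) + stirling₂ n k

module TwinClassCount (P : ∀ {N} → Multiset N → Bool)
  (P⇒AtMostTwice : ∀ {N} (D : Multiset N) → P D ≡ true → AtMostTwice D ≡ true)
  (P-addTwin : ∀ {N} (p : Fin (suc N)) c C → P (TwinInsertion.addTwin p c C) ≡ P C) where

  -- On [j + n], layer j m selects the multisets satisfying P whose first j points are isolated and
  -- whose other n points form m twin classes (each counted by its least point); there are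
  -- stirling₂ n m * twinFreeCount (j + m) of them.
  layer : ∀ {N} → ℕ → ℕ → Multiset N → Bool
  layer j m C = P C ∧ does (isolatedBelow? j C) ∧ does (classesFrom j C ℕₚ.≟ m)

  layerAbove : ∀ {N} → ℕ → ℕ → Multiset N → Bool
  layerAbove j m C = P C ∧ does (isolatedBelow? (suc j) C) ∧ does (suc (classesFrom (suc j) C) ℕₚ.≟ m)

  layer-sound : ∀ {N} j m (C : Multiset N) → layer j m C ≡ true → P C ≡ true × IsolatedBelow j C × classesFrom j C ≡ m
  layer-sound j m C lC with ∧₃-≡true⇒ {P C} lC
  ... | PC , isolated , classes = PC , does⇒ (isolatedBelow? j C) isolated , does⇒ (_ ℕₚ.≟ m) classes

  layer-complete : ∀ {N} j m (C : Multiset N) → P C ≡ true × IsolatedBelow j C × classesFrom j C ≡ m → layer j m C ≡ true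
  layer-complete j m C (PC , isolated , classes) =
    ∧₃-≡true⇐ PC (dec-true (isolatedBelow? j C) isolated) (dec-true (_ ℕₚ.≟ m) classes)

  module Step {N : ℕ} (p : Fin (suc N)) (m : ℕ) where

    open TwinInsertion p
    open TwinClassStep p

    private
      j : ℕ
      j = toℕ p

    pivotHasTwin : Multiset (suc N) → Bool
    pivotHasTwin D = is-just (least (twinOfPivot? D))

    withClassMin : Multiset N × Fin N → Bool
    withClassMin (C , c) = layer j m C ∧ does (classMinFrom? j C c)

    module _ (D : Multiset (suc N)) (pD : (layer j m D ∧ pivotHasTwin D) ≡ true) where

      private
        D-layer : P D ≡ true × IsolatedBelow j D × classesFrom j D ≡ m
        D-layer = layer-sound j m D (proj₁ (∧-≡true⇒ {layer j m D} pD))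

        isolated : IsolatedBelow j D
        isolated = proj₁ (proj₂ D-layer)

      leastTwin : Fin N
      leastTwin = fromJust (least (twinOfPivot? D)) (proj₂ (∧-≡true⇒ {layer j m D} pD))

      private
        leastTwin-least : least (twinOfPivot? D) ≡ just leastTwin
        leastTwin-least = fromJust-≡ (least (twinOfPivot? D)) (proj₂ (∧-≡true⇒ {layer j m D} pD))

      restore-twin : addTwin leastTwin (removeTwin leastTwin D) ≡ D
      restore-twin = addTwin-removeTwin-least D isolated leastTwin-least

      removeTwin-withClassMin : withClassMin (removeTwin leastTwin D , leastTwin) ≡ true
      removeTwin-withClassMin = ∧-≡true⇐ (layer-complete j m _ (P-removed , isolated′ , classes))
        (dec-true (classMinFrom? j _ leastTwin) (above , classMin-removeTwin D isolated leastTwin-least))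
        where
        above : j ≤ toℕ leastTwin
        above = least-twin-above D isolated leastTwin-least
        isolated′ : IsolatedBelow j (removeTwin leastTwin D)
        isolated′ = isolatedBelow-removeTwin D isolated leastTwin-least
        P-removed : P (removeTwin leastTwin D) ≡ true
        P-removed = trans (sym (P-addTwin p leastTwin _)) (trans (cong P restore-twin) (proj₁ D-layer))
        classes : classesFrom j (removeTwin leastTwin D) ≡ m
        classes = trans (sym (classesFrom-addTwin leastTwin _ above isolated′ (classMin-removeTwin D isolated leastTwin-least)))
                        (trans (cong (classesFrom j) restore-twin) (proj₂ (proj₂ D-layer)))

    module _ (C : Multiset N) (c : Fin N) (qC : withClassMin (C , c) ≡ true) where

      private
        C-layer : P C ≡ true × IsolatedBelow j C × classesFrom j C ≡ m
        C-layer = layer-sound j m C (proj₁ (∧-≡true⇒ {layer j m C} qC))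

        c-classMin : j ≤ toℕ c × ClassMin C c
        c-classMin = does⇒ (classMinFrom? j C c) (proj₂ (∧-≡true⇒ {layer j m C} qC))

      addTwin-leastTwin : least (twinOfPivot? (addTwin c C)) ≡ just c
      addTwin-leastTwin = least-twin-addTwin c C (proj₁ c-classMin) (proj₁ (proj₂ C-layer)) (proj₂ c-classMin)

      addTwin-pivotHasTwin : (layer j m (addTwin c C) ∧ pivotHasTwin (addTwin c C)) ≡ true
      addTwin-pivotHasTwin = ∧-≡true⇐
        (layer-complete j m _ (trans (P-addTwin p c C) (proj₁ C-layer) , isolatedBelow-addTwin c C above isolated ,
                               trans (classesFrom-addTwin c C above isolated (proj₂ c-classMin)) (proj₂ (proj₂ C-layer))))
        (cong is-just addTwin-leastTwin)
        where
        above : j ≤ toℕ c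
        above = proj₁ c-classMin
        isolated : IsolatedBelow j C
        isolated = proj₁ (proj₂ C-layer)

    removal : Correspondence (λ D → layer j m D ∧ pivotHasTwin D) withClassMin
    removal = record
      { to = λ D pD → removeTwin (leastTwin D pD) D , leastTwin D pD
      ; from = λ (C , c) → addTwin c C
      ; to-q = removeTwin-withClassMin
      ; from-to = restore-twin
      ; from-p = λ (C , c) → addTwin-pivotHasTwin C c
      ; to-from = λ (C , c) qC →
          let c′≡c = fromJust-just _ (addTwin-leastTwin C c qC)
          in cong₂ _,_ (trans (cong (λ c′ → removeTwin c′ (addTwin c C)) c′≡c) (removeTwin-addTwin c C)) c′≡c
      }

    private
      markedCandidates-enumerate : Enumerates (markedCandidates N) (_≟ₘ_ ×-≟ _≟ᶠ_) (λ (C , _) → AtMostTwice C ∧ true)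
      markedCandidates-enumerate = product-enumerates (candidates-enumerate N) (allFin-enumerates N)

      layer⇒AtMostTwice : ∀ {M} (C : Multiset M) → layer j m C ≡ true → AtMostTwice C ≡ true
      layer⇒AtMostTwice C lC = P⇒AtMostTwice C (proj₁ (∧-≡true⇒ {P C} lC))

    count-pivot-has-twin : ∑ (candidates (suc N)) (λ D → 𝟙 (layer j m D ∧ pivotHasTwin D))
                         ≡ m * ∑ (candidates N) (𝟙 ∘ layer j m)
    count-pivot-has-twin = begin
      ∑ (candidates (suc N)) (λ D → 𝟙 (layer j m D ∧ pivotHasTwin D))
        ≡⟨ ∑𝟙-correspondence (candidates-enumerate (suc N)) markedCandidates-enumerate
             (λ D pD → layer⇒AtMostTwice D (proj₁ (∧-≡true⇒ {layer j m D} pD)))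
             (λ (C , c) qC → ∧-≡true⇐ (layer⇒AtMostTwice C (proj₁ (∧-≡true⇒ {layer j m C} qC))) refl)
             removal ⟩
      ∑ (markedCandidates N) (𝟙 ∘ withClassMin)
        ≡⟨ ∑-concatMap (candidates N) _ _ ⟩
      ∑ (candidates N) (λ C → ∑ (map (C ,_) (allFin N)) (𝟙 ∘ withClassMin))
        ≡⟨ ∑-cong (candidates N) (λ C → trans (∑-map (allFin N) (C ,_) _) (classes C)) ⟩
      ∑ (candidates N) (λ C → m * 𝟙 (layer j m C))
        ≡⟨ ∑-distribˡ-* (candidates N) m _ ⟩
      m * ∑ (candidates N) (𝟙 ∘ layer j m) ∎
      where
      open ≡-Reasoning
      classes : ∀ C → ∑ (allFin N) (λ c → 𝟙 (layer j m C ∧ does (classMinFrom? j C c))) ≡ m * 𝟙 (layer j m C)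
      classes C with layer j m C in lC
      ... | false = trans (∑-zero (allFin N) (λ _ → refl)) (sym (*-zeroʳ m))
      ... | true = trans (proj₂ (proj₂ (layer-sound j m C lC))) (sym (*-identityʳ m))

    pivot-isolated : ∀ D → 𝟙 (layer j m D ∧ not (pivotHasTwin D)) ≡ 𝟙 (layerAbove j m D)
    pivot-isolated D = cong 𝟙 (bool-ext to from)
      where
      to : (layer j m D ∧ not (pivotHasTwin D)) ≡ true → layerAbove j m D ≡ true
      to lD with ∧-≡true⇒ {layer j m D} lD
      ... | lD′ , no-twin with layer-sound j m D lD′
      ...   | PD , isolated , classes = ∧₃-≡true⇐ PD (dec-true (isolatedBelow? (suc j) D) isolated′)
                                          (dec-true (_ ℕₚ.≟ m) (trans (sym (classesFrom-isolated-pivot D isolated′)) classes))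
        where
        isolated′ : IsolatedBelow (suc j) D
        isolated′ = isolatedBelow-suc D isolated (is-just≡false (least (twinOfPivot? D)) (not-≡true no-twin))
      from : layerAbove j m D ≡ true → (layer j m D ∧ not (pivotHasTwin D)) ≡ true
      from lD with ∧₃-≡true⇒ {P D} lD
      ... | PD , isolated , classes =
        ∧-≡true⇐ (layer-complete j m D (PD , (λ x x<j → isolated′ x (m≤n⇒m≤1+n x<j)) ,
                                        trans (classesFrom-isolated-pivot D isolated′) (does⇒ (_ ℕₚ.≟ m) classes)))
                 (cong (not ∘ is-just) (isolatedBelow-suc⁻ D isolated′))
        where
        isolated′ : IsolatedBelow (suc j) D
        isolated′ = does⇒ (isolatedBelow? (suc j) D) isolated

    count-layer : ∑ (candidates (suc N)) (𝟙 ∘ layer j m)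
                ≡ m * ∑ (candidates N) (𝟙 ∘ layer j m) + ∑ (candidates (suc N)) (𝟙 ∘ layerAbove j m)
    count-layer = trans (∑-cong (candidates (suc N)) (λ D → 𝟙-split (layer j m D) (pivotHasTwin D)))
      (trans (∑-distrib-+ (candidates (suc N)) _ _) (cong₂ _+_ count-pivot-has-twin (∑-cong (candidates (suc N)) pivot-isolated)))

  twinFreeCount : ℕ → ℕ
  twinFreeCount k = ∑ (candidates k) (λ C → 𝟙 (P C ∧ does (isolatedBelow? k C)))

  layerCount : ℕ → ℕ → ℕ → ℕ
  layerCount n j m = ∑ (candidates (j + n)) (𝟙 ∘ layer j m)

  private
    count-layer-at : ∀ N j m → j < suc N → ∑ (candidates (suc N)) (𝟙 ∘ layer j m)
                   ≡ m * ∑ (candidates N) (𝟙 ∘ layer j m) + ∑ (candidates (suc N)) (𝟙 ∘ layerAbove j m)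
    count-layer-at N j m j<1+N with Step.count-layer (fromℕ< j<1+N) m
    ... | count rewrite toℕ-fromℕ< j<1+N = count

    classesFrom-all : ∀ j (C : Multiset j) → classesFrom j C ≡ 0
    classesFrom-all j C = ∑-zero (allFin j) λ x → cong 𝟙 (dec-false (classMinFrom? j C x) (<⇒≱ (toℕ<n x) ∘ proj₁))

    layerCount-zero : ∀ j m → layerCount 0 j m ≡ stirling₂ 0 m * twinFreeCount (j + m)
    layerCount-zero j m = begin
      ∑ (candidates (j + 0)) (𝟙 ∘ layer j m)
        ≡⟨ cong (λ N → ∑ (candidates N) (𝟙 ∘ layer j m)) (+-identityʳ j) ⟩
      ∑ (candidates j) (𝟙 ∘ layer j m)
        ≡⟨ ∑-cong (candidates j) (λ C → cong (λ k → 𝟙 (P C ∧ does (isolatedBelow? j C) ∧ does (k ℕₚ.≟ m)))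
                                             (classesFrom-all j C)) ⟩
      ∑ (candidates j) (λ C → 𝟙 (P C ∧ does (isolatedBelow? j C) ∧ does (0 ℕₚ.≟ m)))
        ≡⟨ by-m m ⟩
      stirling₂ 0 m * twinFreeCount (j + m) ∎
      where
      open ≡-Reasoning
      by-m : ∀ m → ∑ (candidates j) (λ C → 𝟙 (P C ∧ does (isolatedBelow? j C) ∧ does (0 ℕₚ.≟ m)))
                 ≡ stirling₂ 0 m * twinFreeCount (j + m)
      by-m zero = trans (∑-cong (candidates j) (λ C → cong 𝟙 (cong (P C ∧_) (∧-identityʳ _))))
                        (trans (cong twinFreeCount (sym (+-identityʳ j))) (sym (+-identityʳ _)))
      by-m (suc m) = ∑-zero (candidates j) (λ C → cong 𝟙 (∧-zeroʳ′ (P C) _))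
        where
        ∧-zeroʳ′ : ∀ a b → (a ∧ b ∧ false) ≡ false
        ∧-zeroʳ′ a b = trans (cong (a ∧_) (∧-zeroʳ b)) (∧-zeroʳ a)

  layerCount-solution : ∀ n j m → layerCount n j m ≡ stirling₂ n m * twinFreeCount (j + m)
  layerCount-solution zero j m = layerCount-zero j m
  layerCount-solution (suc n) j zero = begin
    ∑ (candidates (j + suc n)) (𝟙 ∘ layer j 0)
      ≡⟨ cong (λ N → ∑ (candidates N) (𝟙 ∘ layer j 0)) (+-suc j n) ⟩
    ∑ (candidates (suc (j + n))) (𝟙 ∘ layer j 0)
      ≡⟨ count-layer-at (j + n) j 0 (s≤s (m≤m+n j n)) ⟩
    ∑ (candidates (suc (j + n))) (𝟙 ∘ layerAbove j 0)
      ≡⟨ ∑-zero (candidates (suc (j + n))) (λ D → cong 𝟙 (trans (cong (P D ∧_) (∧-zeroʳ _)) (∧-zeroʳ (P D)))) ⟩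
    0 ∎
    where open ≡-Reasoning
  layerCount-solution (suc n) j (suc m) = begin
    ∑ (candidates (j + suc n)) (𝟙 ∘ layer j (suc m))
      ≡⟨ cong (λ N → ∑ (candidates N) (𝟙 ∘ layer j (suc m))) (+-suc j n) ⟩
    ∑ (candidates (suc (j + n))) (𝟙 ∘ layer j (suc m))
      ≡⟨ count-layer-at (j + n) j (suc m) (s≤s (m≤m+n j n)) ⟩
    suc m * layerCount n j (suc m) + layerCount n (suc j) m
      ≡⟨ cong₂ (λ a b → suc m * a + b) (layerCount-solution n j (suc m)) (layerCount-solution n (suc j) m) ⟩
    suc m * (stirling₂ n (suc m) * twinFreeCount (j + suc m)) + stirling₂ n m * twinFreeCount (suc (j + m))
      ≡⟨ cong (λ k → suc m * (stirling₂ n (suc m) * twinFreeCount k) + stirling₂ n m * twinFreeCount (suc (j + m)))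
              (+-suc j m) ⟩
    suc m * (stirling₂ n (suc m) * twinFreeCount (suc (j + m))) + stirling₂ n m * twinFreeCount (suc (j + m))
      ≡⟨ cong (_+ stirling₂ n m * twinFreeCount (suc (j + m))) (sym (*-assoc (suc m) (stirling₂ n (suc m)) _)) ⟩
    suc m * stirling₂ n (suc m) * twinFreeCount (suc (j + m)) + stirling₂ n m * twinFreeCount (suc (j + m))
      ≡⟨ sym (*-distribʳ-+ (twinFreeCount (suc (j + m))) (suc m * stirling₂ n (suc m)) (stirling₂ n m)) ⟩
    stirling₂ (suc n) (suc m) * twinFreeCount (suc (j + m))
      ≡⟨ cong (λ k → stirling₂ (suc n) (suc m) * twinFreeCount k) (sym (+-suc j m)) ⟩
    stirling₂ (suc n) (suc m) * twinFreeCount (j + suc m) ∎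
    where open ≡-Reasoning

  count-by-twin-classes : ∀ n → ∑ (candidates n) (𝟙 ∘ P) ≡ ∑≤ n (λ m → stirling₂ n m * twinFreeCount m)
  count-by-twin-classes n = sym (begin
    ∑≤ n (λ m → stirling₂ n m * twinFreeCount m)
      ≡⟨ ∑≤-cong n (λ m _ → sym (layerCount-solution n 0 m)) ⟩
    ∑≤ n (λ m → ∑ (candidates n) (𝟙 ∘ layer 0 m))
      ≡⟨ ∑≤-∑-comm n (candidates n) _ ⟩
    ∑ (candidates n) (λ C → ∑≤ n (λ m → 𝟙 (layer 0 m C)))
      ≡⟨ ∑-cong (candidates n) one-class-count ⟩
    ∑ (candidates n) (𝟙 ∘ P) ∎)
    where
    open ≡-Reasoning
    one-class-count : ∀ C → ∑≤ n (λ m → 𝟙 (layer 0 m C)) ≡ 𝟙 (P C)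
    one-class-count C = begin
      ∑≤ n (λ m → 𝟙 (layer 0 m C))
        ≡⟨ ∑≤-cong n (λ m _ → trans (cong (λ b → 𝟙 (P C ∧ b ∧ does (classesFrom 0 C ℕₚ.≟ m)))
                                          (dec-true (isolatedBelow? 0 C) λ _ ()))
                                    (𝟙-∧ (P C) _)) ⟩
      ∑≤ n (λ m → 𝟙 (P C) * 𝟙 (does (classesFrom 0 C ℕₚ.≟ m)))
        ≡⟨ ∑≤-distribˡ-* n (𝟙 (P C)) _ ⟩
      𝟙 (P C) * ∑≤ n (λ m → 𝟙 (does (classesFrom 0 C ℕₚ.≟ m)))
        ≡⟨ cong (𝟙 (P C) *_) (∑≤-indicator n (classesFrom 0 C)
                                 (subst (classesFrom 0 C ≤_) (length-tabulate id) (∑𝟙≤length (allFin n) _))) ⟩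
      𝟙 (P C) * 1
        ≡⟨ *-identityʳ _ ⟩
      𝟙 (P C) ∎

module CoverClasses = TwinClassCount isTwoCover isTwoCover⇒AtMostTwice isTwoCover-addTwin

module ProperCoverClasses = TwinClassCount (λ C → isTwoCover C ∧ isProper C)
  (λ C → isTwoCover⇒AtMostTwice C ∘ proj₁ ∘ ∧-≡true⇒ {isTwoCover C})
  (λ p c C → cong₂ _∧_ (isTwoCover-addTwin p c C) (isProper-addTwin p c C))

s≡∑stirling₂*u : ∀ n → s n ≡ ∑≤ n (λ m → stirling₂ n m * u m)
s≡∑stirling₂*u n = begin
  s n
    ≡⟨ count≡∑𝟙 (λ _ → isTwoCover) n ⟩
  ∑ (candidates n) (𝟙 ∘ isTwoCover)
    ≡⟨ CoverClasses.count-by-twin-classes n ⟩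
  ∑≤ n (λ m → stirling₂ n m * CoverClasses.twinFreeCount m)
    ≡⟨ ∑≤-cong n (λ m _ → cong (stirling₂ n m *_) (twin-free≡u m)) ⟩
  ∑≤ n (λ m → stirling₂ n m * u m) ∎
  where
  open ≡-Reasoning
  twin-free≡u : ∀ m → CoverClasses.twinFreeCount m ≡ u m
  twin-free≡u m = trans (∑-cong (candidates m) (cong 𝟙 ∘ restricted⇔twin-free))
                        (sym (count≡∑𝟙 (λ _ C → isTwoCover C ∧ isRestricted C) m))

t≡∑stirling₂*v : ∀ n → t n ≡ ∑≤ n (λ m → stirling₂ n m * v m)
t≡∑stirling₂*v n = begin
  t n
    ≡⟨ count≡∑𝟙 (λ _ C → isTwoCover C ∧ isProper C) n ⟩
  ∑ (candidates n) (λ C → 𝟙 (isTwoCover C ∧ isProper C))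
    ≡⟨ ProperCoverClasses.count-by-twin-classes n ⟩
  ∑≤ n (λ m → stirling₂ n m * ProperCoverClasses.twinFreeCount m)
    ≡⟨ ∑≤-cong n (λ m _ → cong (stirling₂ n m *_) (twin-free≡v m)) ⟩
  ∑≤ n (λ m → stirling₂ n m * v m) ∎
  where
  open ≡-Reasoning
  reorder : ∀ {m} (C : Multiset m) → ((isTwoCover C ∧ isProper C) ∧ does (isolatedBelow? m C))
                                    ≡ (isTwoCover C ∧ isRestricted C ∧ isProper C)
  reorder {m} C = begin
    (isTwoCover C ∧ isProper C) ∧ does (isolatedBelow? m C)
      ≡⟨ ∧-assoc (isTwoCover C) _ _ ⟩
    isTwoCover C ∧ isProper C ∧ does (isolatedBelow? m C)
      ≡⟨ cong (isTwoCover C ∧_) (∧-comm (isProper C) _) ⟩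
    isTwoCover C ∧ does (isolatedBelow? m C) ∧ isProper C
      ≡⟨ sym (∧-assoc (isTwoCover C) _ _) ⟩
    (isTwoCover C ∧ does (isolatedBelow? m C)) ∧ isProper C
      ≡⟨ cong (_∧ isProper C) (restricted⇔twin-free C) ⟩
    (isTwoCover C ∧ isRestricted C) ∧ isProper C
      ≡⟨ ∧-assoc (isTwoCover C) _ _ ⟩
    isTwoCover C ∧ isRestricted C ∧ isProper C ∎
  twin-free≡v : ∀ m → ProperCoverClasses.twinFreeCount m ≡ v m
  twin-free≡v m = trans (∑-cong (candidates m) (cong 𝟙 ∘ reorder))
                        (sym (count≡∑𝟙 (λ _ C → isTwoCover C ∧ isRestricted C ∧ isProper C) m))

-- Doubled singletons: u from v

module DoubledSingleton {N : ℕ} (p : Fin (suc N)) where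

  open TwinInsertion p using (ins; rem; rem-ins; ins-rem; lookup-ins-pivot; lookup-ins-punchIn; rem-∅)

  deletePivot : Multiset (suc N) → Multiset N
  deletePivot D = subFun (λ T → mult D (ins false T))

  addDoubled : Multiset N → Multiset (suc N)
  addDoubled C = subFun (λ S → if lookup S p then (if does (rem S ≟ˢ ∅) then 2 else 0) else mult C (rem S))

  mult-addDoubled : ∀ C S → mult (addDoubled C) S ≡ (if lookup S p then (if does (rem S ≟ˢ ∅) then 2 else 0) else mult C (rem S))
  mult-addDoubled C = app-subFun _

  mult-addDoubled-outside : ∀ C T → mult (addDoubled C) (ins false T) ≡ mult C T
  mult-addDoubled-outside C T rewrite mult-addDoubled C (ins false T) | lookup-ins-pivot false T | rem-ins false T = refl

  mult-addDoubled-inside : ∀ C T → mult (addDoubled C) (ins true T) ≡ (if does (T ≟ˢ ∅) then 2 else 0)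
  mult-addDoubled-inside C T rewrite mult-addDoubled C (ins true T) | lookup-ins-pivot true T | rem-ins true T = refl

  deletePivot-addDoubled : ∀ C → deletePivot (addDoubled C) ≡ C
  deletePivot-addDoubled C = app-injective _ _ λ T → trans (app-subFun _ T) (mult-addDoubled-outside C T)

  ⁅pivot⁆ : ⁅ p ⁆ ≡ ins true ∅
  ⁅pivot⁆ = lookup-ext _ _ same
    where
    same : ∀ i → lookup ⁅ p ⁆ i ≡ lookup (ins true ∅) i
    same i with punchIn-or-pivot p i
    ... | inj₁ refl rewrite lookup-⁅⁆ p p | lookup-ins-pivot true (∅ {N}) with p ≟ᶠ p
    ...   | yes _ = refl
    ...   | no p≢p = ⊥-elim (p≢p refl)
    same i | inj₂ (x , refl) rewrite lookup-⁅⁆ p (punchIn p x) | lookup-ins-punchIn true (∅ {N}) x | lookup-∅ x =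
      dec-false (p ≟ᶠ punchIn p x) (punchInᵢ≢i p x ∘ sym)

  ⁅punchIn⁆ : ∀ x → ⁅ punchIn p x ⁆ ≡ ins false ⁅ x ⁆
  ⁅punchIn⁆ x = lookup-ext _ _ same
    where
    same : ∀ i → lookup ⁅ punchIn p x ⁆ i ≡ lookup (ins false ⁅ x ⁆) i
    same i with punchIn-or-pivot p i
    ... | inj₁ refl rewrite lookup-⁅⁆ (punchIn p x) p | lookup-ins-pivot false ⁅ x ⁆ =
      dec-false (punchIn p x ≟ᶠ p) (punchInᵢ≢i p x)
    ... | inj₂ (y , refl) rewrite lookup-⁅⁆ (punchIn p x) (punchIn p y) | lookup-ins-punchIn false ⁅ x ⁆ y | lookup-⁅⁆ x y =
      does-⇔ (mk⇔ (punchIn-injective p x y) (cong (punchIn p))) (punchIn p x ≟ᶠ punchIn p y) (x ≟ᶠ y)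

  mult-addDoubled-⁅pivot⁆ : ∀ C → mult (addDoubled C) ⁅ p ⁆ ≡ 2
  mult-addDoubled-⁅pivot⁆ C rewrite ⁅pivot⁆ | mult-addDoubled-inside C (∅ {N}) | dec-true (∅ {N} ≟ˢ ∅) refl = refl

  degree-addDoubled-punchIn : ∀ C x → degree (addDoubled C) (punchIn p x) ≡ degree C x
  degree-addDoubled-punchIn C x = trans (∑-allSubsets-insertAt N p _) (∑-cong (allSubsets N) split)
    where
    split : ∀ T → incidence (addDoubled C) (punchIn p x) (ins false T) + incidence (addDoubled C) (punchIn p x) (ins true T)
                ≡ incidence C x T
    split T rewrite lookup-ins-punchIn false T x | lookup-ins-punchIn true T x
                  | mult-addDoubled-outside C T | mult-addDoubled-inside C T with lookup T x in T∋x
    ... | false = refl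
    ... | true with T ≟ˢ ∅
    ...   | no _ = +-identityʳ _
    ...   | yes refl with trans (sym T∋x) (lookup-∅ x)
    ...     | ()

  degree-addDoubled-pivot : ∀ C → degree (addDoubled C) p ≡ 2
  degree-addDoubled-pivot C = begin
    degree (addDoubled C) p
      ≡⟨ ∑-allSubsets-insertAt N p _ ⟩
    ∑ (allSubsets N) (λ T → incidence (addDoubled C) p (ins false T) + incidence (addDoubled C) p (ins true T))
      ≡⟨ ∑-cong (allSubsets N) split ⟩
    ∑ (allSubsets N) two-at-∅
      ≡⟨ ∑-extract (allSubsets-enumerates N) two-at-∅ ∅ ⟩
    two-at-∅ ∅ + ∑ (allSubsets N) (λ T → if does (T ≟ˢ ∅) then 0 else two-at-∅ T)
      ≡⟨ cong₂ _+_ (cong (λ b → if b then 2 else 0) (dec-true (∅ {N} ≟ˢ ∅) refl)) (∑-zero (allSubsets N) others-zero) ⟩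
    2 ∎
    where
    open ≡-Reasoning
    two-at-∅ : Subset N → ℕ
    two-at-∅ T = if does (T ≟ˢ ∅) then 2 else 0
    split : ∀ T → incidence (addDoubled C) p (ins false T) + incidence (addDoubled C) p (ins true T) ≡ two-at-∅ T
    split T rewrite lookup-ins-pivot false T | lookup-ins-pivot true T | mult-addDoubled-inside C T = refl
    others-zero : ∀ T → (if does (T ≟ˢ ∅) then 0 else two-at-∅ T) ≡ 0
    others-zero T with T ≟ˢ ∅
    ... | yes _ = refl
    ... | no _ = refl

  mult-addDoubled-∅ : ∀ C → mult (addDoubled C) ∅ ≡ mult C ∅
  mult-addDoubled-∅ C rewrite mult-addDoubled C ∅ | lookup-∅ p | rem-∅ = refl

  addDoubled-TwoCover : ∀ C → TwoCover C → TwoCover (addDoubled C)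
  addDoubled-TwoCover C (empty , degrees) = trans (mult-addDoubled-∅ C) empty , degree-two
    where
    degree-two : ∀ y → degree (addDoubled C) y ≡ 2
    degree-two y with punchIn-or-pivot p y
    ... | inj₁ refl = degree-addDoubled-pivot C
    ... | inj₂ (x , refl) = trans (degree-addDoubled-punchIn C x) (degrees x)

  addDoubled-TwoCover⁻ : ∀ C → TwoCover (addDoubled C) → TwoCover C
  addDoubled-TwoCover⁻ C (empty , degrees) =
    trans (sym (mult-addDoubled-∅ C)) empty , λ x → trans (sym (degree-addDoubled-punchIn C x)) (degrees (punchIn p x))

  addDoubled-deletePivot : ∀ D → TwoCover D → mult D ⁅ p ⁆ ≡ 2 → addDoubled (deletePivot D) ≡ D
  addDoubled-deletePivot D cover doubled = app-injective _ _ same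
    where
    ⁅p⁆∋p : ⁅ p ⁆ ∋ p
    ⁅p⁆∋p = trans (lookup-⁅⁆ p p) (dec-true (p ≟ᶠ p) refl)
    same : ∀ S → mult (addDoubled (deletePivot D)) S ≡ mult D S
    same S rewrite mult-addDoubled (deletePivot D) S with lookup S p in S∋p
    ... | false = trans (app-subFun _ (rem S)) (cong (mult D) (trans (cong (λ b → ins b (rem S)) (sym S∋p)) (ins-rem S)))
    ... | true with rem S ≟ˢ ∅
    ...   | yes rem-S≡∅ = sym (trans (cong (mult D) S≡⁅p⁆) doubled)
      where
      S≡⁅p⁆ : S ≡ ⁅ p ⁆
      S≡⁅p⁆ = trans (sym (ins-rem S)) (trans (cong₂ ins S∋p rem-S≡∅) (sym ⁅pivot⁆))
    ...   | no rem-S≢∅ with mult D S in mDS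
    ...     | zero = refl
    ...     | suc _ = ⊥-elim (true≢false (trans (sym S∋p)
                (sole-member cover (≤-reflexive (sym doubled)) ⁅p⁆∋p S S≢⁅p⁆ (subst (1 ≤_) (sym mDS) (s≤s z≤n)))))
      where
      S≢⁅p⁆ : S ≢ ⁅ p ⁆
      S≢⁅p⁆ S≡⁅p⁆ = rem-S≢∅ (trans (cong rem (trans S≡⁅p⁆ ⁅pivot⁆)) (rem-ins true ∅))

  occurs-addDoubled : ∀ C S → Occurs (addDoubled C) S → Occurs C (rem S) ⊎ S ≡ ⁅ p ⁆
  occurs-addDoubled C S occ rewrite mult-addDoubled C S with lookup S p in S∋p
  ... | false = inj₁ occ
  ... | true with rem S ≟ˢ ∅
  ...   | yes rem-S≡∅ = inj₂ (trans (sym (ins-rem S)) (trans (cong₂ ins S∋p rem-S≡∅) (sym ⁅pivot⁆)))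
  ...   | no _ = ⊥-elim (1+n≰n occ)

  twins-addDoubled-punchIn : ∀ C x y → Twins C x y → Twins (addDoubled C) (punchIn p x) (punchIn p y)
  twins-addDoubled-punchIn C x y x~y S occ with occurs-addDoubled C S occ
  ... | inj₁ occ′ = trans (sym (lookup-removeAt S p x)) (trans (x~y (rem S) occ′) (lookup-removeAt S p y))
  ... | inj₂ refl rewrite ⁅pivot⁆ =
    trans (lookup-ins-punchIn true ∅ x) (trans (lookup-∅ x) (sym (trans (lookup-ins-punchIn true ∅ y) (lookup-∅ y))))

  twins-addDoubled-punchIn⁻ : ∀ C x y → Twins (addDoubled C) (punchIn p x) (punchIn p y) → Twins C x y
  twins-addDoubled-punchIn⁻ C x y x~y T occ =
    trans (sym (lookup-ins-punchIn false T x))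
      (trans (x~y (ins false T) (subst (1 ≤_) (sym (mult-addDoubled-outside C T)) occ)) (lookup-ins-punchIn false T y))

  pivot-isolated-addDoubled : ∀ C y → ¬ Twins (addDoubled C) p (punchIn p y)
  pivot-isolated-addDoubled C y p~y = true≢false (begin
    true                                ≡⟨ sym (lookup-ins-pivot true ∅) ⟩
    lookup (ins true ∅) p               ≡⟨ p~y (ins true ∅) occurs ⟩
    lookup (ins true ∅) (punchIn p y)   ≡⟨ lookup-ins-punchIn true ∅ y ⟩
    lookup ∅ y                          ≡⟨ lookup-∅ y ⟩
    false                               ∎)
    where
    open ≡-Reasoning
    occurs : Occurs (addDoubled C) (ins true ∅)
    occurs rewrite mult-addDoubled-inside C (∅ {N}) | dec-true (∅ {N} ≟ˢ ∅) refl = s≤s z≤n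

  addDoubled-TwinFree : ∀ C → TwinFree C → TwinFree (addDoubled C)
  addDoubled-TwinFree C twin-free x′ y′ x′≢y′ x′~y′ with punchIn-or-pivot p x′ | punchIn-or-pivot p y′
  ... | inj₁ refl | inj₁ refl = x′≢y′ refl
  ... | inj₁ refl | inj₂ (y , refl) = pivot-isolated-addDoubled C y x′~y′
  ... | inj₂ (x , refl) | inj₁ refl = pivot-isolated-addDoubled C x (twins-sym x′~y′)
  ... | inj₂ (x , refl) | inj₂ (y , refl) =
    twin-free x y (x′≢y′ ∘ cong (punchIn p)) (twins-addDoubled-punchIn⁻ C x y x′~y′)

  addDoubled-TwinFree⁻ : ∀ C → TwinFree (addDoubled C) → TwinFree C
  addDoubled-TwinFree⁻ C twin-free x y x≢y x~y =
    twin-free (punchIn p x) (punchIn p y) (x≢y ∘ punchIn-injective p x y) (twins-addDoubled-punchIn C x y x~y)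

  isRestricted-addDoubled : ∀ C → TwoCover C → isRestricted (addDoubled C) ≡ isRestricted C
  isRestricted-addDoubled C cover = bool-ext
    (Restricted⇒isRestricted C ∘ TwinFree⇒Restricted cover ∘ addDoubled-TwinFree⁻ C
      ∘ Restricted⇒TwinFree cover′ ∘ isRestricted⇒Restricted (addDoubled C))
    (Restricted⇒isRestricted (addDoubled C) ∘ TwinFree⇒Restricted cover′ ∘ addDoubled-TwinFree C
      ∘ Restricted⇒TwinFree cover ∘ isRestricted⇒Restricted C)
    where
    cover′ : TwoCover (addDoubled C)
    cover′ = addDoubled-TwoCover C cover

NoDoubledBelow : ∀ {N} → ℕ → Multiset N → Set
NoDoubledBelow j D = ∀ x → toℕ x < j → mult D ⁅ x ⁆ ≢ 2

noDoubledBelow? : ∀ {N} j (D : Multiset N) → Dec (NoDoubledBelow j D)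
noDoubledBelow? j D = Finₚ.all? λ x → (toℕ x <? j) →-dec ¬? (mult D ⁅ x ⁆ ℕₚ.≟ 2)

undoubledBelow : ∀ {N} → ℕ → Multiset N → Bool
undoubledBelow j C = (isTwoCover C ∧ isRestricted C) ∧ does (noDoubledBelow? j C)

undoubledBelow-sound : ∀ {N} j (C : Multiset N) → undoubledBelow j C ≡ true →
                       TwoCover C × isRestricted C ≡ true × NoDoubledBelow j C
undoubledBelow-sound j C uC with ∧-≡true⇒ {isTwoCover C ∧ isRestricted C} uC
... | rc , none with ∧-≡true⇒ {isTwoCover C} rc
...   | cover , restricted = isTwoCover⇒TwoCover C cover , restricted , does⇒ (noDoubledBelow? j C) none

undoubledBelow-complete : ∀ {N} j (C : Multiset N) →
                          TwoCover C × isRestricted C ≡ true × NoDoubledBelow j C → undoubledBelow j C ≡ true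
undoubledBelow-complete j C (cover , restricted , none) =
  ∧-≡true⇐ (∧-≡true⇐ (TwoCover⇒isTwoCover C cover) restricted) (dec-true (noDoubledBelow? j C) none)

module DoubledStep {N : ℕ} (p : Fin (suc N)) where

  open TwinInsertion p using (ins; lookup-ins-pivot)
  open DoubledSingleton p

  private
    j : ℕ
    j = toℕ p

  pivotDoubled : Multiset (suc N) → Bool
  pivotDoubled D = does (mult D ⁅ p ⁆ ℕₚ.≟ 2)

  noDoubled-addDoubled : ∀ C → NoDoubledBelow j C → NoDoubledBelow j (addDoubled C)
  noDoubled-addDoubled C none x′ x′<j with punchIn-or-pivot p x′
  ... | inj₁ refl = ⊥-elim (1+n≰n x′<j)
  ... | inj₂ (x , refl) = none x (punchIn<pivot⇒ p x x′<j)
                        ∘ trans (sym (trans (cong (mult (addDoubled C)) (⁅punchIn⁆ x)) (mult-addDoubled-outside C ⁅ x ⁆)))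

  noDoubled-addDoubled⁻ : ∀ C → NoDoubledBelow j (addDoubled C) → NoDoubledBelow j C
  noDoubled-addDoubled⁻ C none x x<j =
    none (punchIn p x) (subst (_< j) (sym (toℕ-punchIn-< p x x<j)) x<j)
    ∘ trans (trans (cong (mult (addDoubled C)) (⁅punchIn⁆ x)) (mult-addDoubled-outside C ⁅ x ⁆))

  module _ (D : Multiset (suc N)) (pD : (undoubledBelow j D ∧ pivotDoubled D) ≡ true) where

    private
      D-undoubled : TwoCover D × isRestricted D ≡ true × NoDoubledBelow j D
      D-undoubled = undoubledBelow-sound j D (proj₁ (∧-≡true⇒ {undoubledBelow j D} pD))

    restore-doubled : addDoubled (deletePivot D) ≡ D
    restore-doubled =
      addDoubled-deletePivot D (proj₁ D-undoubled) (does⇒ (_ ℕₚ.≟ 2) (proj₂ (∧-≡true⇒ {undoubledBelow j D} pD)))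

    deletePivot-undoubled : undoubledBelow j (deletePivot D) ≡ true
    deletePivot-undoubled = undoubledBelow-complete j _ (cover ,
      trans (sym (isRestricted-addDoubled _ cover)) (trans (cong isRestricted restore-doubled) (proj₁ (proj₂ D-undoubled))) ,
      noDoubled-addDoubled⁻ _ (subst (NoDoubledBelow j) (sym restore-doubled) (proj₂ (proj₂ D-undoubled))))
      where
      cover : TwoCover (deletePivot D)
      cover = addDoubled-TwoCover⁻ _ (subst TwoCover (sym restore-doubled) (proj₁ D-undoubled))

  addDoubled-undoubled : ∀ C → undoubledBelow j C ≡ true →
                         (undoubledBelow j (addDoubled C) ∧ pivotDoubled (addDoubled C)) ≡ true
  addDoubled-undoubled C uC with undoubledBelow-sound j C uC
  ... | cover , restricted , none = ∧-≡true⇐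
    (undoubledBelow-complete j _ (addDoubled-TwoCover C cover , trans (isRestricted-addDoubled C cover) restricted ,
                                  noDoubled-addDoubled C none))
    (dec-true (_ ℕₚ.≟ 2) (mult-addDoubled-⁅pivot⁆ C))

  removal : Correspondence (λ D → undoubledBelow j D ∧ pivotDoubled D) (undoubledBelow j)
  removal = record
    { to = λ D _ → deletePivot D ; from = addDoubled ; to-q = deletePivot-undoubled ; from-to = restore-doubled
    ; from-p = addDoubled-undoubled ; to-from = λ C _ → deletePivot-addDoubled C }

  pivot-undoubled : ∀ D → 𝟙 (undoubledBelow j D ∧ not (pivotDoubled D)) ≡ 𝟙 (undoubledBelow (suc j) D)
  pivot-undoubled D = cong 𝟙 (trans (∧-assoc (isTwoCover D ∧ isRestricted D) _ _)
                                    (cong ((isTwoCover D ∧ isRestricted D) ∧_)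
                                      (does-⇔ (mk⇔ to from) (noDoubledBelow? j D ×-dec ¬? (mult D ⁅ p ⁆ ℕₚ.≟ 2))
                                                            (noDoubledBelow? (suc j) D))))
    where
    to : NoDoubledBelow j D × ¬ mult D ⁅ p ⁆ ≡ 2 → NoDoubledBelow (suc j) D
    to (none , p-single) x x<1+j with toℕ x <? j
    ... | yes x<j = none x x<j
    ... | no x≮j with toℕ-injective {i = x} {j = p} (≤-antisym (≤-pred x<1+j) (≮⇒≥ x≮j))
    ...   | refl = p-single
    from : NoDoubledBelow (suc j) D → NoDoubledBelow j D × ¬ mult D ⁅ p ⁆ ≡ 2
    from none = (λ x x<j → none x (m≤n⇒m≤1+n x<j)) , none p ≤-refl

  count-undoubled : ∑ (candidates (suc N)) (𝟙 ∘ undoubledBelow j)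
                  ≡ ∑ (candidates N) (𝟙 ∘ undoubledBelow j) + ∑ (candidates (suc N)) (𝟙 ∘ undoubledBelow (suc j))
  count-undoubled = trans (∑-cong (candidates (suc N)) (λ D → 𝟙-split (undoubledBelow j D) (pivotDoubled D)))
    (trans (∑-distrib-+ (candidates (suc N)) _ _)
      (cong₂ _+_ (∑𝟙-correspondence (candidates-enumerate (suc N)) (candidates-enumerate N)
                   (λ D pD → undoubled⇒AtMostTwice D (proj₁ (∧-≡true⇒ {undoubledBelow j D} pD)))
                   undoubled⇒AtMostTwice
                   removal)
                 (∑-cong (candidates (suc N)) pivot-undoubled)))
    where
    undoubled⇒AtMostTwice : ∀ {M} (C : Multiset M) → undoubledBelow j C ≡ true → AtMostTwice C ≡ true
    undoubled⇒AtMostTwice C = TwoCover⇒AtMostTwice C ∘ proj₁ ∘ undoubledBelow-sound j C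

fully-undoubled : ∀ {k} (C : Multiset k) → undoubledBelow k C ≡ (isTwoCover C ∧ isRestricted C ∧ isProper C)
fully-undoubled {k} C = bool-ext to from
  where
  to : undoubledBelow k C ≡ true → (isTwoCover C ∧ isRestricted C ∧ isProper C) ≡ true
  to uC with undoubledBelow-sound k C uC
  ... | cover , restricted , none = ∧₃-≡true⇐ (TwoCover⇒isTwoCover C cover) restricted (Proper⇒isProper C proper)
    where
    proper : Proper C
    proper S with 2 ≤? mult C S
    ... | no 2≰mS = ≤-pred (≰⇒> 2≰mS)
    ... | yes 2≤mS with ∅-or-nonempty S
    ...   | inj₁ refl = ⊥-elim (n≮0 (subst (2 ≤_) (proj₁ cover) 2≤mS))
    ...   | inj₂ (x , S∋x) = ⊥-elim (none x (toℕ<n x)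
              (≤-antisym (TwoCover⇒mult≤2 C cover ⁅ x ⁆) (subst (λ S → 2 ≤ mult C S) S≡⁅x⁆ 2≤mS)))
      where
      S≡⁅x⁆ : S ≡ ⁅ x ⁆
      S≡⁅x⁆ = ⁅⁆-unique S x S∋x (λ y S∋y → proj₂ (isRestricted⇒Restricted C restricted) S 2≤mS y x S∋y S∋x)
  from : (isTwoCover C ∧ isRestricted C ∧ isProper C) ≡ true → undoubledBelow k C ≡ true
  from rcp with ∧₃-≡true⇒ {isTwoCover C} rcp
  ... | cover , restricted , isP = undoubledBelow-complete k C (isTwoCover⇒TwoCover C cover , restricted ,
          λ x _ doubled → 1+n≰n (subst (_≤ 1) doubled (isProper⇒Proper C isP ⁅ x ⁆)))

undoubledCount : ℕ → ℕ → ℕ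
undoubledCount n j = ∑ (candidates (j + n)) (𝟙 ∘ undoubledBelow j)

undoubledCount-zero : ∀ j → undoubledCount 0 j ≡ v j
undoubledCount-zero j = begin
  ∑ (candidates (j + 0)) (𝟙 ∘ undoubledBelow j)
    ≡⟨ cong (λ N → ∑ (candidates N) (𝟙 ∘ undoubledBelow j)) (+-identityʳ j) ⟩
  ∑ (candidates j) (𝟙 ∘ undoubledBelow j)
    ≡⟨ ∑-cong (candidates j) (cong 𝟙 ∘ fully-undoubled) ⟩
  ∑ (candidates j) (λ C → 𝟙 (isTwoCover C ∧ isRestricted C ∧ isProper C))
    ≡⟨ sym (count≡∑𝟙 (λ _ C → isTwoCover C ∧ isRestricted C ∧ isProper C) j) ⟩
  v j ∎
  where open ≡-Reasoning

undoubledCount-suc : ∀ n j → undoubledCount (suc n) j ≡ undoubledCount n j + undoubledCount n (suc j)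
undoubledCount-suc n j =
  trans (cong (λ N → ∑ (candidates N) (𝟙 ∘ undoubledBelow j)) (+-suc j n)) (count-at (j + n) j (s≤s (m≤m+n j n)))
  where
  count-at : ∀ N j → j < suc N → ∑ (candidates (suc N)) (𝟙 ∘ undoubledBelow j)
           ≡ ∑ (candidates N) (𝟙 ∘ undoubledBelow j) + ∑ (candidates (suc N)) (𝟙 ∘ undoubledBelow (suc j))
  count-at N j j<1+N with DoubledStep.count-undoubled (fromℕ< j<1+N)
  ... | count rewrite toℕ-fromℕ< j<1+N = count

undoubledCount-solution : ∀ n j → undoubledCount n j ≡ ∑≤ n (λ k → (n choose k) * v (j + k))
undoubledCount-solution zero j = trans (undoubledCount-zero j) (trans (cong v (sym (+-identityʳ j))) (sym (+-identityʳ _)))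
undoubledCount-solution (suc n) j = begin
  undoubledCount (suc n) j
    ≡⟨ undoubledCount-suc n j ⟩
  undoubledCount n j + undoubledCount n (suc j)
    ≡⟨ cong₂ _+_ (undoubledCount-solution n j) (undoubledCount-solution n (suc j)) ⟩
  ∑≤ n (λ k → (n choose k) * v (j + k)) + ∑≤ n (λ k → (n choose k) * v (suc j + k))
    ≡⟨ cong (∑≤ n (λ k → (n choose k) * v (j + k)) +_)
            (∑≤-cong n λ k _ → cong (λ i → (n choose k) * v i) (sym (+-suc j k))) ⟩
  ∑≤ n (λ k → (n choose k) * v (j + k)) + ∑≤ n (λ k → (n choose k) * v (j + suc k))
    ≡⟨ sym (∑≤-pascal n (λ k → v (j + k))) ⟩
  ∑≤ (suc n) (λ k → (suc n choose k) * v (j + k)) ∎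
  where open ≡-Reasoning

u≡∑binomial*v : ∀ n → u n ≡ ∑≤ n (λ k → (n choose k) * v k)
u≡∑binomial*v n = begin
  u n
    ≡⟨ count≡∑𝟙 (λ _ C → isTwoCover C ∧ isRestricted C) n ⟩
  ∑ (candidates n) (λ C → 𝟙 (isTwoCover C ∧ isRestricted C))
    ≡⟨ ∑-cong (candidates n) (λ C → cong 𝟙 (sym (trans (cong ((isTwoCover C ∧ isRestricted C) ∧_)
                                                              (dec-true (noDoubledBelow? 0 C) λ _ ()))
                                                        (∧-identityʳ _)))) ⟩
  undoubledCount n 0
    ≡⟨ undoubledCount-solution n 0 ⟩
  ∑≤ n (λ k → (n choose k) * v k) ∎
  where open ≡-Reasoning

-- Stirling numbers and the powers of e^x - 1

binomial-factorials : ∀ n k → k ≤ n → (n choose k) * (k ! * (n ∸ k) !) ≡ n !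
binomial-factorials n k k≤n =
  trans (cong (_* (k ! * (n ∸ k) !)) (nCk≡n!/k![n-k]! k≤n)) (m/n*n≡m {{k !* (n ∸ k) !≢0}} (k![n∸k]!∣n! k≤n))

∑≤-choose-stirling₂ : ∀ n m → ∑≤ n (λ i → (n choose i) * stirling₂ i m) ≡ stirling₂ (suc n) (suc m)
∑≤-choose-stirling₂ zero zero = refl
∑≤-choose-stirling₂ zero (suc m) = sym (cong (_+ 0) (*-zeroʳ (suc (suc m))))
∑≤-choose-stirling₂ (suc n) m = trans (∑≤-pascal n (λ i → stirling₂ i m)) (by-m m)
  where
  R : ℕ → ℕ
  R m = ∑≤ n (λ i → (n choose i) * stirling₂ i m)
  by-m : ∀ m → R m + ∑≤ n (λ i → (n choose i) * stirling₂ (suc i) m) ≡ stirling₂ (suc (suc n)) (suc m)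
  by-m zero = begin
    R 0 + ∑≤ n (λ i → (n choose i) * stirling₂ (suc i) 0)
      ≡⟨ cong (R 0 +_) (∑≤-zero n λ i _ → *-zeroʳ (n choose i)) ⟩
    R 0 + 0
      ≡⟨ +-identityʳ _ ⟩
    R 0
      ≡⟨ ∑≤-choose-stirling₂ n 0 ⟩
    stirling₂ (suc n) 1
      ≡⟨ sym (trans (+-identityʳ _) (*-identityˡ _)) ⟩
    1 * stirling₂ (suc n) 1 + 0 ∎
    where open ≡-Reasoning
  by-m (suc m) = begin
    R (suc m) + ∑≤ n (λ i → (n choose i) * stirling₂ (suc i) (suc m))
      ≡⟨ cong (R (suc m) +_) (∑≤-cong n λ i _ → trans (*-distribˡ-+ (n choose i) (suc m * stirling₂ i (suc m)) (stirling₂ i m))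
                                                      (cong (_+ (n choose i) * stirling₂ i m) (*-left-comm (n choose i) (suc m) _))) ⟩
    R (suc m) + ∑≤ n (λ i → suc m * ((n choose i) * stirling₂ i (suc m)) + (n choose i) * stirling₂ i m)
      ≡⟨ cong (R (suc m) +_) (trans (∑≤-distrib-+ n _ _) (cong (_+ R m) (∑≤-distribˡ-* n (suc m) _))) ⟩
    R (suc m) + (suc m * R (suc m) + R m)
      ≡⟨ sym (+-assoc (R (suc m)) _ _) ⟩
    suc (suc m) * R (suc m) + R m
      ≡⟨ cong₂ (λ a b → suc (suc m) * a + b) (∑≤-choose-stirling₂ n (suc m)) (∑≤-choose-stirling₂ n m) ⟩
    stirling₂ (suc (suc n)) (suc (suc m)) ∎
    where open ≡-Reasoning

-- (k + 1) S(n, k + 1) counts partitions of [n] into k + 1 blocks one of which is marked;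
-- markedBlock n k i counts those whose marked block has i elements.
markedBlock : ℕ → ℕ → ℕ → ℕ
markedBlock n k zero = 0
markedBlock n k (suc i) = (n choose suc i) * stirling₂ (n ∸ suc i) k

∑≤-markedBlock : ∀ n k → ∑≤ n (markedBlock n k) ≡ suc k * stirling₂ n (suc k)
∑≤-markedBlock n k = +-cancelʳ-≡ (stirling₂ n k) _ _ (begin
  ∑≤ n (markedBlock n k) + stirling₂ n k
    ≡⟨ cong (_+ stirling₂ n k) (∑≤-reverse n (markedBlock n k)) ⟩
  ∑≤ n (λ i → markedBlock n k (n ∸ i)) + stirling₂ n k
    ≡⟨ reversed n ⟩
  ∑≤ n (λ i → (n choose i) * stirling₂ i k)
    ≡⟨ ∑≤-choose-stirling₂ n k ⟩
  suc k * stirling₂ n (suc k) + stirling₂ n k ∎)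
  where
  open ≡-Reasoning
  reversed : ∀ n → ∑≤ n (λ i → markedBlock n k (n ∸ i)) + stirling₂ n k
                 ≡ ∑≤ n (λ i → (n choose i) * stirling₂ i k)
  reversed zero = sym (*-identityˡ (stirling₂ 0 k))
  reversed (suc n) = begin
    ∑≤ n (λ i → markedBlock (suc n) k (suc n ∸ i)) + markedBlock (suc n) k (suc n ∸ suc n) + stirling₂ (suc n) k
      ≡⟨ cong (λ j → ∑≤ n (λ i → markedBlock (suc n) k (suc n ∸ i)) + markedBlock (suc n) k j + stirling₂ (suc n) k)
              (n∸n≡0 n) ⟩
    ∑≤ n (λ i → markedBlock (suc n) k (suc n ∸ i)) + 0 + stirling₂ (suc n) k
      ≡⟨ cong (_+ stirling₂ (suc n) k) (trans (+-identityʳ _) (∑≤-cong n term)) ⟩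
    ∑≤ n (λ i → (suc n choose i) * stirling₂ i k) + stirling₂ (suc n) k
      ≡⟨ cong (∑≤ n (λ i → (suc n choose i) * stirling₂ i k) +_)
              (sym (trans (cong (_* stirling₂ (suc n) k) (nCn≡1 (suc n))) (*-identityˡ _))) ⟩
    ∑≤ (suc n) (λ i → (suc n choose i) * stirling₂ i k) ∎
    where
    term : ∀ i → i ≤ n → markedBlock (suc n) k (suc n ∸ i) ≡ (suc n choose i) * stirling₂ i k
    term i i≤n = trans (cong (markedBlock (suc n) k) (+-∸-assoc 1 i≤n)) $ cong₂ _*_
      (trans (cong (suc n choose_) (sym (+-∸-assoc 1 i≤n))) (sym (nCk≡nC[n∸k] (m≤n⇒m≤1+n i≤n))))
      (cong (λ j → stirling₂ j k) (trans (cong (suc n ∸_) (sym (+-∸-assoc 1 i≤n))) (m∸[m∸n]≡n (m≤n⇒m≤1+n i≤n))))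

instance
  *-nonZero : ∀ {m n} → {{NonZero m}} → {{NonZero n}} → NonZero (m * n)
  *-nonZero {m} {n} = m*n≢0 m n

infixl 7 _÷_

_÷_ : ℕ → (d : ℕ) → .{{NonZero d}} → ℚ
a ÷ d = ℤ.+ a / d

toℚᵘ-÷ : ∀ a d .{{_ : NonZero d}} → toℚᵘ (a ÷ d) ≃ᵘ (ℤ.+ a /ᵘ d)
toℚᵘ-÷ a (suc d) = toℚᵘ-fromℚᵘ (mkℚᵘ (ℤ.+ a) d)

÷-cross : ∀ a b d e .{{_ : NonZero d}} .{{_ : NonZero e}} → a * e ≡ b * d → a ÷ d ≡ b ÷ e
÷-cross a b d@(suc _) e@(suc _) ae≡bd = toℚᵘ-injective (≃ᵘ-trans (toℚᵘ-÷ a d)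
  (≃ᵘ-trans (*≡* (trans (sym (pos-* a e)) (trans (cong ℤ.+_ ae≡bd) (pos-* b d)))) (≃ᵘ-sym (toℚᵘ-÷ b e))))

÷-+ : ∀ a b d e .{{_ : NonZero d}} .{{_ : NonZero e}} → a ÷ d +ℚ b ÷ e ≡ (a * e + b * d) ÷ (d * e)
÷-+ a b d@(suc _) e@(suc e′) = toℚᵘ-injective (≃ᵘ-trans (toℚᵘ-homo-+ (a ÷ d) (b ÷ e))
  (≃ᵘ-trans (+ᵘ-cong (toℚᵘ-÷ a d) (toℚᵘ-÷ b e))
  (≃ᵘ-trans (≃ᵘ-reflexive numerator) (≃ᵘ-sym (toℚᵘ-÷ _ (d * e))))))
  where
  numerator : (ℤ.+ a /ᵘ d) +ᵘ (ℤ.+ b /ᵘ e) ≡ ℤ.+ (a * e + b * d) /ᵘ (d * e)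
  numerator = cong (λ z → mkℚᵘ z (e′ + pred d * e))
    (trans (cong₂ ℤ._+_ (sym (pos-* a e)) (sym (pos-* b d))) (sym (pos-+ (a * e) (b * d))))

÷-* : ∀ a b d e .{{_ : NonZero d}} .{{_ : NonZero e}} → (a ÷ d) *ℚ (b ÷ e) ≡ (a * b) ÷ (d * e)
÷-* a b d@(suc _) e@(suc e′) = toℚᵘ-injective (≃ᵘ-trans (toℚᵘ-homo-* (a ÷ d) (b ÷ e))
  (≃ᵘ-trans (*ᵘ-cong (toℚᵘ-÷ a d) (toℚᵘ-÷ b e))
  (≃ᵘ-trans (≃ᵘ-reflexive numerator) (≃ᵘ-sym (toℚᵘ-÷ _ (d * e))))))
  where
  numerator : (ℤ.+ a /ᵘ d) *ᵘ (ℤ.+ b /ᵘ e) ≡ ℤ.+ (a * b) /ᵘ (d * e)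
  numerator = cong (λ z → mkℚᵘ z (e′ + pred d * e)) (sym (pos-* a b))

0ℚ≡0÷ : ∀ d .{{_ : NonZero d}} → 0ℚ ≡ 0 ÷ d
0ℚ≡0÷ d = ÷-cross 0 0 1 d refl

÷-+-same : ∀ a b d .{{_ : NonZero d}} → a ÷ d +ℚ b ÷ d ≡ (a + b) ÷ d
÷-+-same a b d = trans (÷-+ a b d d) (÷-cross (a * d + b * d) (a + b) (d * d) d
  (trans (cong (_* d) (sym (*-distribʳ-+ d a b))) (*-assoc (a + b) d d)))

sumTo-cong : ∀ n {f g : ℕ → ℚ} → (∀ k → k ≤ n → f k ≡ g k) → sumTo n f ≡ sumTo n g
sumTo-cong zero f≡g = f≡g 0 z≤n
sumTo-cong (suc n) f≡g = cong₂ _+ℚ_ (sumTo-cong n (λ k k≤n → f≡g k (m≤n⇒m≤1+n k≤n))) (f≡g (suc n) ≤-refl)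

sumTo-÷ : ∀ n (g : ℕ → ℕ) d .{{_ : NonZero d}} → sumTo n (λ k → g k ÷ d) ≡ ∑≤ n g ÷ d
sumTo-÷ zero g d = refl
sumTo-÷ (suc n) g d = trans (cong (_+ℚ g (suc n) ÷ d) (sumTo-÷ n g d)) (÷-+-same (∑≤ n g) (g (suc n)) d)

expm1^-coefficient : ∀ k n → (expm1 ^S k) n ≡ ((k ! * stirling₂ n k) ÷ n !) {{n !≢0}}
expm1^-coefficient zero zero = refl
expm1^-coefficient zero (suc n) = 0ℚ≡0÷ (suc n !) {{suc n !≢0}}
expm1^-coefficient (suc k) n = begin
  sumTo n (λ i → expm1 i *ℚ (expm1 ^S k) (n ∸ i))
    ≡⟨ sumTo-cong n term ⟩
  sumTo n (λ i → ((k ! * markedBlock n k i) ÷ n !) {{n !≢0}})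
    ≡⟨ sumTo-÷ n (λ i → k ! * markedBlock n k i) (n !) {{n !≢0}} ⟩
  (∑≤ n (λ i → k ! * markedBlock n k i) ÷ n !) {{n !≢0}}
    ≡⟨ cong (λ a → (a ÷ n !) {{n !≢0}}) (trans (∑≤-distribˡ-* n (k !) (markedBlock n k))
                                               (cong (k ! *_) (∑≤-markedBlock n k))) ⟩
  ((k ! * (suc k * stirling₂ n (suc k))) ÷ n !) {{n !≢0}}
    ≡⟨ cong (λ a → (a ÷ n !) {{n !≢0}}) (x∙yz≈yx∙z′ (k !) (suc k) (stirling₂ n (suc k))) ⟩
  ((suc k ! * stirling₂ n (suc k)) ÷ n !) {{n !≢0}} ∎
  where
  open ≡-Reasoning
  x∙yz≈yx∙z′ : ∀ x y z → x * (y * z) ≡ y * x * z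
  x∙yz≈yx∙z′ x y z = trans (*-left-comm x y z) (sym (*-assoc y x z))
  term : ∀ i → i ≤ n → expm1 i *ℚ (expm1 ^S k) (n ∸ i) ≡ ((k ! * markedBlock n k i) ÷ n !) {{n !≢0}}
  term zero _ = trans (ℚₚ.*-zeroˡ ((expm1 ^S k) n))
                      (trans (0ℚ≡0÷ (n !) {{n !≢0}}) (cong (λ a → (a ÷ n !) {{n !≢0}}) (sym (*-zeroʳ (k !)))))
  term (suc i) i<n = begin
    expS (suc i) *ℚ (expm1 ^S k) (n ∸ suc i)
      ≡⟨ cong (expS (suc i) *ℚ_) (expm1^-coefficient k (n ∸ suc i)) ⟩
    (1 ÷ suc i !) {{suc i !≢0}} *ℚ ((k ! * stirling₂ (n ∸ suc i) k) ÷ (n ∸ suc i) !) {{(n ∸ suc i) !≢0}}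
      ≡⟨ ÷-* 1 (k ! * stirling₂ (n ∸ suc i) k) (suc i !) ((n ∸ suc i) !) {{suc i !≢0}} {{(n ∸ suc i) !≢0}} ⟩
    ((1 * (k ! * stirling₂ (n ∸ suc i) k)) ÷ (suc i ! * (n ∸ suc i) !)) {{m*n≢0 _ _ {{suc i !≢0}} {{(n ∸ suc i) !≢0}}}}
      ≡⟨ ÷-cross (1 * (k ! * stirling₂ (n ∸ suc i) k)) (k ! * markedBlock n k (suc i)) (suc i ! * (n ∸ suc i) !) (n !)
                 {{m*n≢0 _ _ {{suc i !≢0}} {{(n ∸ suc i) !≢0}}}} {{n !≢0}} cross ⟩
    ((k ! * markedBlock n k (suc i)) ÷ n !) {{n !≢0}} ∎
    where
    cross : 1 * (k ! * stirling₂ (n ∸ suc i) k) * n !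
          ≡ k ! * ((n choose suc i) * stirling₂ (n ∸ suc i) k) * (suc i ! * (n ∸ suc i) !)
    cross = begin
      1 * (k ! * stirling₂ (n ∸ suc i) k) * n !
        ≡⟨ cong (1 * (k ! * stirling₂ (n ∸ suc i) k) *_) (sym (binomial-factorials n (suc i) i<n)) ⟩
      1 * (k ! * stirling₂ (n ∸ suc i) k) * ((n choose suc i) * (suc i ! * (n ∸ suc i) !))
        ≡⟨ solve 5 (λ f s c a b → con 1 :* (f :* s) :* (c :* (a :* b)) := f :* (c :* s) :* (a :* b)) refl
                 (k !) (stirling₂ (n ∸ suc i) k) (n choose suc i) (suc i !) ((n ∸ suc i) !) ⟩
      k ! * ((n choose suc i) * stirling₂ (n ∸ suc i) k) * (suc i ! * (n ∸ suc i) !) ∎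

egf-∘-expm1 : ∀ (a b : ℕ → ℕ) → (∀ n → a n ≡ ∑≤ n (λ k → stirling₂ n k * b k)) →
              ∀ n → egf a n ≡ (egf b ∘S expm1) n
egf-∘-expm1 a b a≡∑ n = sym (begin
  sumTo n (λ k → egf b k *ℚ (expm1 ^S k) n)
    ≡⟨ sumTo-cong n (λ k _ → term k) ⟩
  sumTo n (λ k → ((stirling₂ n k * b k) ÷ n !) {{n !≢0}})
    ≡⟨ sumTo-÷ n (λ k → stirling₂ n k * b k) (n !) {{n !≢0}} ⟩
  (∑≤ n (λ k → stirling₂ n k * b k) ÷ n !) {{n !≢0}}
    ≡⟨ cong (λ x → (x ÷ n !) {{n !≢0}}) (sym (a≡∑ n)) ⟩
  egf a n ∎)
  where
  open ≡-Reasoning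
  term : ∀ k → egf b k *ℚ (expm1 ^S k) n ≡ ((stirling₂ n k * b k) ÷ n !) {{n !≢0}}
  term k = begin
    egf b k *ℚ (expm1 ^S k) n
      ≡⟨ cong (egf b k *ℚ_) (expm1^-coefficient k n) ⟩
    (b k ÷ k !) {{k !≢0}} *ℚ ((k ! * stirling₂ n k) ÷ n !) {{n !≢0}}
      ≡⟨ ÷-* (b k) (k ! * stirling₂ n k) (k !) (n !) {{k !≢0}} {{n !≢0}} ⟩
    ((b k * (k ! * stirling₂ n k)) ÷ (k ! * n !)) {{m*n≢0 _ _ {{k !≢0}} {{n !≢0}}}}
      ≡⟨ ÷-cross (b k * (k ! * stirling₂ n k)) (stirling₂ n k * b k) (k ! * n !) (n !)
                 {{m*n≢0 _ _ {{k !≢0}} {{n !≢0}}}} {{n !≢0}}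
           (solve 4 (λ b f s m → b :* (f :* s) :* m := s :* b :* (f :* m)) refl (b k) (k !) (stirling₂ n k) (n !)) ⟩
    ((stirling₂ n k * b k) ÷ n !) {{n !≢0}} ∎

egf-⊛-expS : ∀ (a b : ℕ → ℕ) → (∀ n → a n ≡ ∑≤ n (λ k → (n choose k) * b k)) →
             ∀ n → egf a n ≡ (egf b ⊛ expS) n
egf-⊛-expS a b a≡∑ n = sym (begin
  sumTo n (λ k → egf b k *ℚ expS (n ∸ k))
    ≡⟨ sumTo-cong n term ⟩
  sumTo n (λ k → (((n choose k) * b k) ÷ n !) {{n !≢0}})
    ≡⟨ sumTo-÷ n (λ k → (n choose k) * b k) (n !) {{n !≢0}} ⟩
  (∑≤ n (λ k → (n choose k) * b k) ÷ n !) {{n !≢0}}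
    ≡⟨ cong (λ x → (x ÷ n !) {{n !≢0}}) (sym (a≡∑ n)) ⟩
  egf a n ∎)
  where
  open ≡-Reasoning
  term : ∀ k → k ≤ n → egf b k *ℚ expS (n ∸ k) ≡ (((n choose k) * b k) ÷ n !) {{n !≢0}}
  term k k≤n = begin
    (b k ÷ k !) {{k !≢0}} *ℚ (1 ÷ (n ∸ k) !) {{(n ∸ k) !≢0}}
      ≡⟨ ÷-* (b k) 1 (k !) ((n ∸ k) !) {{k !≢0}} {{(n ∸ k) !≢0}} ⟩
    ((b k * 1) ÷ (k ! * (n ∸ k) !)) {{m*n≢0 _ _ {{k !≢0}} {{(n ∸ k) !≢0}}}}
      ≡⟨ ÷-cross (b k * 1) ((n choose k) * b k) (k ! * (n ∸ k) !) (n !)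
                 {{m*n≢0 _ _ {{k !≢0}} {{(n ∸ k) !≢0}}}} {{n !≢0}} cross ⟩
    (((n choose k) * b k) ÷ n !) {{n !≢0}} ∎
    where
    cross : b k * 1 * n ! ≡ (n choose k) * b k * (k ! * (n ∸ k) !)
    cross = begin
      b k * 1 * n !
        ≡⟨ cong (b k * 1 *_) (sym (binomial-factorials n k k≤n)) ⟩
      b k * 1 * ((n choose k) * (k ! * (n ∸ k) !))
        ≡⟨ solve 3 (λ b c f → b :* con 1 :* (c :* f) := c :* b :* f) refl
                                                                   (b k) (n choose k) (k ! * (n ∸ k) !) ⟩
      (n choose k) * b k * (k ! * (n ∸ k) !) ∎

proposition3 : (∀ n → egf s n ≡ (egf u ∘S expm1) n)
             × (∀ n → egf t n ≡ (egf v ∘S expm1) n)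
             × (∀ n → egf u n ≡ (egf v ⊛ expS) n)
proposition3 = egf-∘-expm1 s u s≡∑stirling₂*u
             , egf-∘-expm1 t v t≡∑stirling₂*v
             , egf-⊛-expS u v u≡∑binomial*v
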